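{- Let $\phi$ be any 3CNF formula with $m$ clauses. If the GE3 proof system cannot refute $\phi$ (viewed as the system of linear equations modulo 2 in which each clause $(\ell_1,\ell_2,\ell_3)$ becomes the equation $\ell_1+\ell_2+\ell_3 = 1$), then $\vartheta(G_{\phi}^{xor}) = m$.
   Context: A 3CNF formula over variables $x_1,\dots,x_n$ is a collection of $m$ clauses, each consisting of exactly three literals (a literal is a variable $x_i$ or its negation $\bar{x}_i$) over three distinct variables. Modulo 2, the literal $\bar{x}_i$ is identified with $1+x_i$. The GE3 proof system: it receives a system of linear equations modulo 2, each with at most three literals. A new equation may be derived only if it is the result of adding exactly two existing (given or previously derived) equations and simplifying modulo 2 (using $1\pm 1=0$, $x_i\pm x_i = 0$, $x_i \pm \bar{x}_i = 1$), and the result contains at most three variables. The system is refuted if the equation $0=1$ can be derived. The graph $G_{\phi}^{xor}$: for each clause of $\phi$ there is a "cloud" of 4 vertices, one for each assignment of truth values to the three literals of the clause under which an odd number of the three literals are true. Two vertices (in the same cloud or in different clouds) are adjacent iff their associated partial assignments are contradicting, i.e. some variable is set to true by one and to false by the other. $\vartheta(G)$ denotes the Lovász theta function of a graph $G$ on vertex set $\{1,\dots,N\}$; equivalently, it is the maximum of $\sum_{i=1}^N \langle v_0, v_i\rangle$ over vectors $v_0, v_1,\dots,v_N$ in a real inner product space satisfying $\langle v_0,v_0\rangle=1$, $\langle v_i,v_i\rangle = \langle v_i,v_0\rangle$ for all $i\ge 1$, $\langle v_i,v_j\rangle \ge 0$ for all pairs $i,j$, and $\langle v_i,v_j\rangle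 = 0$ for every edge $(i,j)$ of $G$. -}

module Defs where

open import Data.Nat using (ℕ; zero; suc) renaming (_*_ to _*ℕ_; _≤_ to _≤ℕ_)
open import Data.Bool using (Bool; true; false; _xor_)
open import Data.Fin using (Fin; zero; suc; quotRem)
open import Data.Fin.Subset using (∣_∣)
open import Data.Vec using (Vec; tabulate; zipWith; replicate)
open import Data.Product using (Σ; ∃; ∃-syntax; _×_; _,_; proj₁; proj₂)
open import Relation.Nullary using (¬_; does)
open import Relation.Binary.PropositionalEquality using (_≡_)
open import Relation.Binary.Structures using (IsTotalOrder)
open import Algebra.Structures using (IsCommutativeRing)
import Data.Fin as F

-- A literal over n variables: a variable and a "negated" flag
-- (true means the literal is  x̄ᵢ).
Literal : ℕ → Set
Literal n = Fin n × Bool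

var : ∀ {n} → Literal n → Fin n
var = proj₁

neg : ∀ {n} → Literal n → Bool
neg = proj₂

record Clause (n : ℕ) : Set where
  field
    lit      : Fin 3 → Literal n
    distinct : ∀ p q → var (lit p) ≡ var (lit q) → p ≡ q
open Clause public

CNF3 : ℕ → ℕ → Set
CNF3 n m = Fin m → Clause n

-- Linear equations mod 2 (normalised: literal x̄ = 1 + x).
-- An equation  Σ_{i : coeff i = true} xᵢ = const.

Equation : ℕ → Set
Equation n = Vec Bool n × Bool

nvars : ∀ {n} → Equation n → ℕ
nvars e = ∣ proj₁ e ∣

_⊕ₑ_ : ∀ {n} → Equation n → Equation n → Equation n
(c , b) ⊕ₑ (c' , b') = zipWith _xor_ c c' , (b xor b')

xor3 : (Fin 3 → Bool) → Bool
xor3 f = f zero xor (f (suc zero) xor f (suc (suc zero)))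

clauseEq : ∀ {n} → Clause n → Equation n
clauseEq C =
  tabulate (λ x → xor3 (λ p → does (var (lit C p) F.≟ x)))
  , (true xor xor3 (λ p → neg (lit C p)))

data GE3Derivable {n m : ℕ} (φ : CNF3 n m) : Equation n → Set where
  given : ∀ j → GE3Derivable φ (clauseEq (φ j))
  add   : ∀ {e e'} → GE3Derivable φ e → GE3Derivable φ e' →
          nvars (e ⊕ₑ e') ≤ℕ 3 → GE3Derivable φ (e ⊕ₑ e')

contradiction : ∀ {n} → Equation n
contradiction {n} = replicate n false , true

GE3Refutes : ∀ {n m} → CNF3 n m → Set
GE3Refutes φ = GE3Derivable φ contradiction

-- The graph G_φ^xor.  Vertex  i : Fin (m * 4)  is the pair
-- (a , j) = quotRem 4 i : clause j, odd assignment number a.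

oddAssignment : Fin 4 → Fin 3 → Bool
oddAssignment zero                   p = does (p F.≟ zero)
oddAssignment (suc zero)             p = does (p F.≟ suc zero)
oddAssignment (suc (suc zero))       p = does (p F.≟ suc (suc zero))
oddAssignment (suc (suc (suc zero))) p = true

-- value assigned to the variable of the p-th literal of clause C
-- when that literal gets truth value b:  x = b xor neg
varValue : ∀ {n} → Clause n → Fin 4 → Fin 3 → Bool
varValue C a p = oddAssignment a p xor neg (lit C p)

XorAdj : ∀ {n m} → CNF3 n m → Fin (m *ℕ 4) → Fin (m *ℕ 4) → Set
XorAdj {n} {m} φ u v =
  let (a , j) = quotRem {m} 4 u
      (b , k) = quotRem {m} 4 v
  in ∃[ p ] ∃[ q ] (var (lit (φ j) p) ≡ var (lit (φ k) q)
                    × ¬ (varValue (φ j) a p ≡ varValue (φ k) b q))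

-- The real numbers, axiomatised as a complete ordered field
-- (unique up to isomorphism).

record RealField : Set₁ where
  infixl 6 _+_
  infixl 7 _*_
  infix 4 _≤_
  field
    Carrier : Set
    _+_ _*_ : Carrier → Carrier → Carrier
    -_      : Carrier → Carrier
    0# 1#   : Carrier
    _≤_     : Carrier → Carrier → Set
    isCommutativeRing : IsCommutativeRing _≡_ _+_ _*_ -_ 0# 1#
    isTotalOrder      : IsTotalOrder _≡_ _≤_
    0≢1     : ¬ (0# ≡ 1#)
    inverse : ∀ x → ¬ (x ≡ 0#) → ∃[ y ] (x * y ≡ 1#)
    +-mono  : ∀ x y z → x ≤ y → x + z ≤ y + z
    *-nonneg : ∀ x y → 0# ≤ x → 0# ≤ y → 0# ≤ x * y
    complete : (P : Carrier → Set) → (∃[ x ] P x) →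
               (∃[ u ] (∀ x → P x → x ≤ u)) →
               ∃[ s ] ((∀ x → P x → x ≤ s) ×
                       (∀ u → (∀ x → P x → x ≤ u) → s ≤ u))

module Theta (ℝ : RealField) where
  open RealField ℝ

  sumF : ∀ {k} → (Fin k → Carrier) → Carrier
  sumF {zero}  f = 0#
  sumF {suc k} f = f zero + sumF (λ i → f (suc i))

  fromℕ : ℕ → Carrier
  fromℕ zero    = 0#
  fromℕ (suc k) = 1# + fromℕ k

  ⟨_,_⟩ : ∀ {d} → (Fin d → Carrier) → (Fin d → Carrier) → Carrier
  ⟨ x , y ⟩ = sumF (λ i → x i * y i)

  Feasible : ∀ {N} → (Fin N → Fin N → Set) → (d : ℕ) →
             (Fin d → Carrier) → (Fin N → Fin d → Carrier) → Set
  Feasible {N} E d v₀ v =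
    (⟨ v₀ , v₀ ⟩ ≡ 1#)
    × (∀ i → ⟨ v i , v i ⟩ ≡ ⟨ v i , v₀ ⟩)
    × (∀ i → 0# ≤ ⟨ v₀ , v i ⟩)
    × (∀ i j → 0# ≤ ⟨ v i , v j ⟩)
    × (∀ i j → E i j → ⟨ v i , v j ⟩ ≡ 0#)

  objective : ∀ {N d} → (Fin d → Carrier) → (Fin N → Fin d → Carrier) → Carrier
  objective v₀ v = sumF (λ i → ⟨ v₀ , v i ⟩)

  ThetaEq : ∀ {N} → (Fin N → Fin N → Set) → Carrier → Set
  ThetaEq E t =
    (∀ d v₀ v → Feasible E d v₀ v → objective v₀ v ≤ t)
    × (∃[ d ] ∃[ v₀ ] ∃[ v ] (Feasible E d v₀ v × objective v₀ v ≡ t))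

-- ϑ ≤ m: the four vertices of a clause are pairwise contradicting, and for a clique the theta
-- constraints give ∑ ⟨v₀, vᵢ⟩ ≤ 1 by expanding ‖v₀ − ∑ vᵢ‖² ≥ 0.
--
-- ϑ ≥ m: read the derivable equations in at most two variables as a union–find structure.  Starting
-- from the identity, merge a root into another root or into the constant whenever a reduced clause,
-- or the sum of two reduced clauses, is a nontrivial equation in at most two variables; each merge is
-- a GE3 step.  When no merge applies, every clause has three distinct roots, or one fixed literal and
-- a root occurring twice, or only fixed literals, and two clauses sharing two roots share all three
-- with the same parity (GE3 cannot derive 0 = 1).  The vertex of a clause and an odd assignment gets
-- ¼ (e₀ + ∑ₚ ± e_{root of literal p}), signs read off the assignment and fixed literals folded into
-- e₀: this vanishes when the assignment contradicts a fixed literal and is otherwise a multiple of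
-- e₀ plus ± the distinct roots.  A Gram entry is then a product of these multiples times 1 + ∑ ±1
-- over the shared roots, which is nonnegative and zero for contradicting vertices, and each clause
-- contributes exactly 1 to the objective.
module Submission where

open import Defs
open import Data.Nat using (ℕ)
open import Relation.Nullary using (¬_)

open import Level using (0ℓ)
open import Algebra.Bundles using (Semiring; CommutativeRing)
open import Data.Bool using (Bool; true; false; _xor_; not; if_then_else_; _∨_)
open import Data.Bool.Properties
  using (xor-∧-commutativeRing; xor-identityʳ; xor-same; xor-assoc; ∨-zeroʳ; not-involutive; ¬-not)
open import Data.Empty using (⊥; ⊥-elim)
open import Data.Fin using (Fin; zero; suc; _↑ˡ_; _↑ʳ_; quotRem; combine)
import Data.Fin.Properties as Fin
open import Data.Fin.Patterns using (0F; 1F; 2F; 3F)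
open import Data.Fin.Subset using (∣_∣)
open import Data.Integer as ℤ using (ℤ; +_; -[1+_]; 0ℤ; 1ℤ; -1ℤ; +≤+)
import Data.Integer.Properties as ℤ
open import Data.Integer.Tactic.RingSolver using () renaming (ring to ℤ-ring)
open import Data.Maybe using (just; nothing)
open import Data.Nat as ℕ using (zero; suc; z≤n; s≤s)
import Data.Nat.Properties as ℕ
open import Data.Product using (Σ; ∃; ∃₂; ∃-syntax; _×_; _,_; proj₁; proj₂; map₂; swap)
import Data.Sign as Sign
open import Data.Sum as Sum using (_⊎_; inj₁; inj₂; [_,_]′)
open import Data.Unit using (⊤; tt)
open import Data.Vec using (_∷_; tabulate; zipWith; replicate)
open import Data.Vec.Functional using (Vector)
open import Data.Vec.Properties using (tabulate-cong)
open import Function using (_∘_; id; Injective)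
open import Relation.Binary.PropositionalEquality
open import Relation.Binary.Structures using (IsTotalOrder)
open import Relation.Nullary using (Dec; does; yes; no)
open import Relation.Nullary.Decidable using (from-yes; dec-true; dec-false; _⊎-dec_; _→-dec_; ¬?)
open import Tactic.RingSolver using (solve-∀)
open import Tactic.RingSolver.Core.AlmostCommutativeRing using (AlmostCommutativeRing; fromCommutativeRing)

-- Since 1 + 1 = 0 in the coefficients, the ring solver over (Bool, xor, ∧) also cancels a xor a.
xor-ring : AlmostCommutativeRing 0ℓ 0ℓ
xor-ring = fromCommutativeRing xor-∧-commutativeRing λ { false → just refl ; true → nothing }

xor-cancelʳ : ∀ u v w → u xor w ≡ v xor w → u ≡ v
xor-cancelʳ u v w e = trans (sym (unshift u w)) (trans (cong (_xor w) e) (unshift v w))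
  where
  unshift : ∀ u w → (u xor w) xor w ≡ u
  unshift = solve-∀ xor-ring

xor-true : ∀ a b → a xor b ≡ true → a ≡ true ⊎ b ≡ true
xor-true true  b _      = inj₁ refl
xor-true false b b≡true = inj₂ b≡true

xor-≡ : ∀ a b → a xor b ≡ false → a ≡ b
xor-≡ false false _ = refl
xor-≡ true  true  _ = refl

-- the position other than i and i' (junk when i ≡ i')
third : Fin 3 → Fin 3 → Fin 3
third 0F 1F = 2F
third 1F 0F = 2F
third 0F _  = 1F
third 1F _  = 0F
third 2F 0F = 1F
third 2F _  = 0F

third-cases : ∀ i i' → i ≢ i' → ∀ p → p ≡ i ⊎ p ≡ i' ⊎ p ≡ third i i'
third-cases = from-yes (Fin.all? λ i → Fin.all? λ i' → ¬? (i Fin.≟ i') →-dec Fin.all? λ p →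
  (p Fin.≟ i) ⊎-dec (p Fin.≟ i') ⊎-dec (p Fin.≟ third i i'))

xor3-third : ∀ f {i i'} → i ≢ i' → xor3 f ≡ f i xor (f i' xor f (third i i'))
xor3-third f {0F} {0F} i≢i' = ⊥-elim (i≢i' refl)
xor3-third f {0F} {1F} _    = refl
xor3-third f {0F} {2F} _    = lemma (f 0F) (f 1F) (f 2F)
  where lemma : ∀ a b c → a xor (b xor c) ≡ a xor (c xor b)
        lemma = solve-∀ xor-ring
xor3-third f {1F} {0F} _    = lemma (f 0F) (f 1F) (f 2F)
  where lemma : ∀ a b c → a xor (b xor c) ≡ b xor (a xor c)
        lemma = solve-∀ xor-ring
xor3-third f {1F} {1F} i≢i' = ⊥-elim (i≢i' refl)
xor3-third f {1F} {2F} _    = lemma (f 0F) (f 1F) (f 2F)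
  where lemma : ∀ a b c → a xor (b xor c) ≡ b xor (c xor a)
        lemma = solve-∀ xor-ring
xor3-third f {2F} {0F} _    = lemma (f 0F) (f 1F) (f 2F)
  where lemma : ∀ a b c → a xor (b xor c) ≡ c xor (a xor b)
        lemma = solve-∀ xor-ring
xor3-third f {2F} {1F} _    = lemma (f 0F) (f 1F) (f 2F)
  where lemma : ∀ a b c → a xor (b xor c) ≡ c xor (b xor a)
        lemma = solve-∀ xor-ring
xor3-third f {2F} {2F} i≢i' = ⊥-elim (i≢i' refl)

xor3-odd : ∀ a → xor3 (oddAssignment a) ≡ true
xor3-odd 0F = refl
xor3-odd 1F = refl
xor3-odd 2F = refl
xor3-odd 3F = refl

odd-assignments-differ : ∀ a b → a ≢ b → ∃ λ p → oddAssignment a p ≢ oddAssignment b p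
odd-assignments-differ = from-yes (Fin.all? λ a → Fin.all? λ b → ¬? (a Fin.≟ b) →-dec
  Fin.any? λ p → ¬? (oddAssignment a p Data.Bool.≟ oddAssignment b p))

search : ∀ {k} {P : Fin k → Set} {X : Set} → (∀ i → P i ⊎ X) → (∀ i → P i) ⊎ X
search {zero}  check = inj₁ λ ()
search {suc k} check with check zero | search (check ∘ suc)
... | inj₂ x  | _       = inj₂ x
... | inj₁ _  | inj₂ x  = inj₂ x
... | inj₁ p₀ | inj₁ ps = inj₁ λ { zero → p₀ ; (suc i) → ps i }

module SumProperties (R : Semiring 0ℓ 0ℓ) where
  open Semiring R hiding (zero) renaming (refl to ≈-refl; sym to ≈-sym; trans to ≈-trans; reflexive to ≈-reflexive)
  open import Algebra.Properties.Semiring.Sum R public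

  sum-single : ∀ {k} (f : Vector Carrier k) a → (∀ b → b ≢ a → f b ≈ 0#) → sum f ≈ f a
  sum-single {suc k} f zero f≈0 =
    ≈-trans (+-congˡ (≈-trans (sum-cong-≋ λ b → f≈0 (suc b) λ ()) (sum-replicate-zero k))) (+-identityʳ _)
  sum-single {suc k} f (suc a) f≈0 =
    ≈-trans (+-congʳ (f≈0 zero λ ())) (≈-trans (+-identityˡ _)
      (sum-single (f ∘ suc) a λ b b≢a → f≈0 (suc b) (b≢a ∘ Fin.suc-injective)))

  sum-↑ : ∀ k {l} (f : Vector Carrier (k ℕ.+ l)) → sum f ≈ sum (f ∘ (_↑ˡ l)) + sum (f ∘ (k ↑ʳ_))
  sum-↑ zero    f = ≈-sym (+-identityˡ _)
  sum-↑ (suc k) f = ≈-trans (+-congˡ (sum-↑ k (f ∘ suc))) (≈-sym (+-assoc _ _ _))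

  sum-quotRem : ∀ m {k} (g : Fin k × Fin m → Carrier) →
                sum (λ i → g (quotRem {m} k i)) ≈ ∑[ j < m ] ∑[ a < k ] g (a , j)
  sum-quotRem zero    g = ≈-refl
  sum-quotRem (suc m) {k} g = ≈-trans (sum-↑ k _) (+-cong
    (≈-reflexive (sum-cong-≗ λ a → cong (g ∘ decode) (Fin.splitAt-↑ˡ k a (m ℕ.* k))))
    (≈-trans (≈-reflexive (sum-cong-≗ λ i → cong (g ∘ decode) (Fin.splitAt-↑ʳ k (m ℕ.* k) i)))
             (sum-quotRem m (g ∘ map₂ suc))))
    where decode = [ (_, zero) , map₂ suc ∘ quotRem {m} k ]′

module ℤ∑ = SumProperties ℤ.+-*-semiring

-- Linear forms over GF(2)

module _ where
  open import Data.Nat using (_≤_; _<_)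

  Form : ℕ → Set
  Form n = Fin n → Bool

  infixl 6 _⊕_
  _⊕_ : ∀ {n} → Form n → Form n → Form n
  (f ⊕ g) i = f i xor g i

  𝟎 : ∀ {n} → Form n
  𝟎 _ = false

  -- An atom is the constant (zero) or a variable (suc x).
  form : ∀ {n} → Fin (suc n) → Form n
  form t x = does (t Fin.≟ suc x)

  width : ∀ {n} → Form n → ℕ
  width {zero}  f = 0
  width {suc n} f = (if f zero then 1 else 0) ℕ.+ width (f ∘ suc)

  ∣tabulate∣≡width : ∀ {n} (f : Form n) → ∣ tabulate f ∣ ≡ width f
  ∣tabulate∣≡width {zero}  f = refl
  ∣tabulate∣≡width {suc n} f with f zero
  ... | true  = cong suc (∣tabulate∣≡width (f ∘ suc))
  ... | false = ∣tabulate∣≡width (f ∘ suc)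

  tabulate-⊕ : ∀ {n} (f g : Form n) → zipWith _xor_ (tabulate f) (tabulate g) ≡ tabulate (f ⊕ g)
  tabulate-⊕ {zero}  f g = refl
  tabulate-⊕ {suc n} f g = cong ((f zero xor g zero) ∷_) (tabulate-⊕ (f ∘ suc) (g ∘ suc))

  tabulate-𝟎 : ∀ {n} → tabulate (𝟎 {n}) ≡ replicate n false
  tabulate-𝟎 {zero}  = refl
  tabulate-𝟎 {suc n} = cong (false ∷_) (tabulate-𝟎 {n})

  form-self : ∀ {n} (x : Fin n) → form (suc x) x ≡ true
  form-self x = dec-true (x Fin.≟ x) refl

  form-true : ∀ {n} (t : Fin (suc n)) x → form t x ≡ true → t ≡ suc x
  form-true t x _ with t Fin.≟ suc x
  form-true t x _  | yes t≡x = t≡x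
  form-true t x () | no  _

  width-cong : ∀ {n} {f g : Form n} → f ≗ g → width f ≡ width g
  width-cong {zero}  eq = refl
  width-cong {suc n} eq = cong₂ (λ b w → (if b then 1 else 0) ℕ.+ w) (eq zero) (width-cong (eq ∘ suc))

  width-𝟎 : ∀ {n} → width (𝟎 {n}) ≡ 0
  width-𝟎 {zero}  = refl
  width-𝟎 {suc n} = width-𝟎 {n}

  width≡0 : ∀ {n} (f : Form n) → width f ≡ 0 → f ≗ 𝟎
  width≡0 {suc n} f w≡0 i with f zero in f₀
  width≡0 {suc n} f w≡0 zero    | false = f₀
  width≡0 {suc n} f w≡0 (suc i) | false = width≡0 (f ∘ suc) w≡0 i

  width≤n : ∀ {n} (f : Form n) → width f ≤ n
  width≤n {zero}  f = z≤n
  width≤n {suc n} f with f zero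
  ... | true  = s≤s (width≤n (f ∘ suc))
  ... | false = ℕ.m≤n⇒m≤1+n (width≤n (f ∘ suc))

  width-⊕ : ∀ {n} (f g : Form n) → width (f ⊕ g) ≤ width f ℕ.+ width g
  width-⊕ {zero}  f g = z≤n
  width-⊕ {suc n} f g with f zero | g zero | width-⊕ (f ∘ suc) (g ∘ suc)
  ... | false | false | w≤ = w≤
  ... | true  | false | w≤ = s≤s w≤
  ... | false | true  | w≤ = ℕ.≤-trans (s≤s w≤) (ℕ.≤-reflexive (sym (ℕ.+-suc _ _)))
  ... | true  | true  | w≤ = ℕ.≤-trans w≤ (ℕ.≤-trans (ℕ.n≤1+n _) (s≤s (ℕ.+-monoʳ-≤ _ (ℕ.n≤1+n _))))

  width-form : ∀ {n} (t : Fin (suc n)) → width (form t) ≤ 1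
  width-form {zero}  t             = z≤n
  width-form {suc n} zero          = ℕ.≤-trans (ℕ.≤-reflexive (width-𝟎 {n})) z≤n
  width-form {suc n} (suc zero)    = ℕ.≤-reflexive (cong suc (width-𝟎 {n}))
  width-form {suc n} (suc (suc x)) = width-form (suc x)

  width₂ : ∀ {n} (t t' : Fin (suc n)) → width (form t ⊕ form t') ≤ 2
  width₂ t t' = ℕ.≤-trans (width-⊕ (form t) (form t')) (ℕ.+-mono-≤ (width-form t) (width-form t'))

  width₃ : ∀ {n} (t t' t'' : Fin (suc n)) → width (form t ⊕ (form t' ⊕ form t'')) ≤ 3
  width₃ t t' t'' = ℕ.≤-trans (width-⊕ (form t) _) (ℕ.+-mono-≤ (width-form t) (width₂ t' t''))

  width-mono : ∀ {n} (f g : Form n) → (∀ x → f x ≡ true → g x ≡ true) → width f ≤ width g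
  width-mono {zero}  f g f⊆g = z≤n
  width-mono {suc n} f g f⊆g with f zero in f₀ | g zero in g₀ | width-mono (f ∘ suc) (g ∘ suc) (f⊆g ∘ suc)
  ... | false | false | w≤ = w≤
  ... | false | true  | w≤ = ℕ.m≤n⇒m≤1+n w≤
  ... | true  | true  | w≤ = s≤s w≤
  ... | true  | false | _ with () ← trans (sym g₀) (f⊆g zero f₀)

  width-mono-< : ∀ {n} (f g : Form n) → (∀ x → f x ≡ true → g x ≡ true) →
                 ∀ a → f a ≡ false → g a ≡ true → width f < width g
  width-mono-< {suc n} f g f⊆g zero f₀ g₀ rewrite f₀ | g₀ = s≤s (width-mono (f ∘ suc) (g ∘ suc) (f⊆g ∘ suc))
  width-mono-< {suc n} f g f⊆g (suc a) fa ga
    with f zero in f₀ | g zero in g₀ | width-mono-< (f ∘ suc) (g ∘ suc) (f⊆g ∘ suc) a fa ga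
  ... | false | false | w< = w<
  ... | false | true  | w< = ℕ.m≤n⇒m≤1+n w<
  ... | true  | true  | w< = s≤s w<
  ... | true  | false | _ with () ← trans (sym g₀) (f⊆g zero f₀)

  width-⊕-form : ∀ {n} (f : Form n) a → f a ≡ true → suc (width (f ⊕ form (suc a))) ≡ width f
  width-⊕-form {suc n} f zero f₀ rewrite f₀ =
    cong suc (width-cong {f = λ i → f (suc i) xor false} (xor-identityʳ ∘ f ∘ suc))
  width-⊕-form {suc n} f (suc a) fa with f zero
  ... | true  = cong suc (width-⊕-form (f ∘ suc) a fa)
  ... | false = width-⊕-form (f ∘ suc) a fa

  width≤1⇒form : ∀ {n} (f : Form n) → width f ≤ 1 → ∃ λ t → f ≗ form t
  width≤1⇒form {zero}  f _ = zero , λ ()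
  width≤1⇒form {suc n} f w≤1 with f zero in f₀
  ... | true  = suc zero , λ { zero → f₀ ; (suc i) → width≡0 (f ∘ suc) (ℕ.n≤0⇒n≡0 (ℕ.≤-pred w≤1)) i }
  ... | false with width≤1⇒form (f ∘ suc) w≤1
  ...   | zero  , f≗ = zero , λ { zero → f₀ ; (suc i) → f≗ i }
  ...   | suc b , f≗ = suc (suc b) , λ { zero → f₀ ; (suc i) → f≗ i }

  width≤2⇒form⊕form : ∀ {n} (f : Form n) a → width f ≤ 2 → f a ≡ true → ∃ λ t → f ≗ form (suc a) ⊕ form t
  width≤2⇒form⊕form f a w≤2 fa = map₂ (λ g≗ i → trans (lemma (f i) (form (suc a) i)) (cong (form (suc a) i xor_) (g≗ i)))
    (width≤1⇒form (f ⊕ form (suc a)) (ℕ.≤-pred (subst (_≤ 2) (sym (width-⊕-form f a fa)) w≤2)))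
    where
    lemma : ∀ x y → x ≡ y xor (x xor y)
    lemma = solve-∀ xor-ring

-- Profiles: the integer vectors of the vertices and their Gram entries

module _ where
  open import Data.Integer using (_+_; _*_)
  open ℤ∑ using (sum; sum-syntax; sum-single; sum-cong-≗; ∑-comm; sum-replicate-zero; *-distribˡ-sum; *-distribʳ-sum)

  sgn : Bool → ℤ
  sgn false = 1ℤ
  sgn true  = -1ℤ

  sgn-xor : ∀ a b → sgn (a xor b) ≡ sgn a * sgn b
  sgn-xor false false = refl
  sgn-xor false true  = refl
  sgn-xor true  false = refl
  sgn-xor true  true  = refl

  δ : ∀ {k} → Fin k → Fin k → ℤ
  δ a b = if does (a Fin.≟ b) then 1ℤ else 0ℤ

  δ-≡ : ∀ {k} {a b : Fin k} → a ≡ b → δ a b ≡ 1ℤ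
  δ-≡ {a = a} {b} a≡b = cong (if_then 1ℤ else 0ℤ) (dec-true (a Fin.≟ b) a≡b)

  δ-≢ : ∀ {k} {a b : Fin k} → a ≢ b → δ a b ≡ 0ℤ
  δ-≢ {a = a} {b} a≢b = cong (if_then 1ℤ else 0ℤ) (dec-false (a Fin.≟ b) a≢b)

  δ-sum : ∀ {k} a (f : Fin k → ℤ) → ∑[ b < k ] (δ a b * f b) ≡ f a
  δ-sum a f = trans (sum-single _ a λ b b≢a → trans (cong (_* f b) (δ-≢ (b≢a ∘ sym))) (ℤ.*-zeroˡ (f b)))
                    (trans (cong (_* f a) (δ-≡ {a = a} refl)) (ℤ.*-identityˡ (f a)))

  record Vanishing (v : ℤ) (C : Set) : Set where
    field
      nonneg   : 0ℤ ℤ.≤ v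
      vanishes : C → v ≡ 0ℤ

  parity-agreement : ∀ a b c → a xor (b xor c) ≡ false →
                     Vanishing (1ℤ + (sgn a + (sgn b + (sgn c + 0ℤ)))) (a ∨ b ∨ c ≡ true)
  parity-agreement false false false _ = record { nonneg = +≤+ ℕ.z≤n ; vanishes = λ () }
  parity-agreement false true  true  _ = record { nonneg = +≤+ ℕ.z≤n ; vanishes = λ _ → refl }
  parity-agreement true  false true  _ = record { nonneg = +≤+ ℕ.z≤n ; vanishes = λ _ → refl }
  parity-agreement true  true  false _ = record { nonneg = +≤+ ℕ.z≤n ; vanishes = λ _ → refl }
  parity-agreement false false true  ()
  parity-agreement false true  false ()
  parity-agreement true  false false ()
  parity-agreement true  true  true  ()

  sign-agreement : ∀ s b → Vanishing (1ℤ + sgn s * sgn b) (b ≡ not s)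
  sign-agreement false false = record { nonneg = +≤+ ℕ.z≤n ; vanishes = λ () }
  sign-agreement false true  = record { nonneg = +≤+ ℕ.z≤n ; vanishes = λ _ → refl }
  sign-agreement true  false = record { nonneg = +≤+ ℕ.z≤n ; vanishes = λ _ → refl }
  sign-agreement true  true  = record { nonneg = +≤+ ℕ.z≤n ; vanishes = λ () }

  some-true : ∀ (e : Fin 3 → Bool) q → e q ≡ true → e 0F ∨ e 1F ∨ e 2F ≡ true
  some-true e 0F e₀ rewrite e₀ = refl
  some-true e 1F e₁ rewrite e₁ = ∨-zeroʳ (e 0F)
  some-true e 2F e₂ rewrite e₂ = trans (cong (e 0F ∨_) (∨-zeroʳ (e 1F))) (∨-zeroʳ (e 0F))

  -- Four times the vertex vectors, in the coordinates e₀ (zero) and e_x (suc x): dead is 0, fixed is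
  -- 4 e₀, single r s is 2 (e₀ ± e_r), and triple r _ s is e₀ ± e_{r 0} ± e_{r 1} ± e_{r 2}, where
  -- the sign of a root is − when its value is true.
  data Profile (n : ℕ) : Set where
    dead   : Profile n
    fixed  : Profile n
    single : Fin n → Bool → Profile n
    triple : (r : Fin 3 → Fin n) → Injective _≡_ _≡_ r → (Fin 3 → Bool) → Profile n

  module _ {n : ℕ} where

    weight : Profile n → ℕ
    weight dead           = 0
    weight fixed          = 4
    weight (single _ _)   = 2
    weight (triple _ _ _) = 1

    signs : Profile n → Fin n → ℤ
    signs dead           x = 0ℤ
    signs fixed          x = 0ℤ
    signs (single r s)   x = sgn s * δ r x
    signs (triple r _ s) x = ∑[ q < 3 ] (sgn (s q) * δ (r q) x)

    vector : Profile n → Fin (suc n) → ℤ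
    vector P zero    = + weight P
    vector P (suc x) = + weight P * signs P x

    gram : Profile n → Profile n → ℤ
    gram P P' = ∑[ y < suc n ] (vector P y * vector P' y)

    correlation : Profile n → Profile n → ℤ
    correlation P P' = ∑[ x < n ] (signs P x * signs P' x)

    gram-correlation : ∀ P P' → gram P P' ≡ + weight P * + weight P' * (1ℤ + correlation P P')
    gram-correlation P P' = begin
      w * w' + ∑[ x < n ] ((w * signs P x) * (w' * signs P' x))
        ≡⟨ cong (λ z → w * w' + z) (sum-cong-≗ λ x → interchange w (signs P x) w' (signs P' x)) ⟩
      w * w' + ∑[ x < n ] ((w * w') * (signs P x * signs P' x))
        ≡⟨ cong (λ z → w * w' + z) (sym (*-distribˡ-sum (w * w') (λ x → signs P x * signs P' x))) ⟩
      w * w' + w * w' * correlation P P'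
        ≡⟨ factor (w * w') (correlation P P') ⟩
      w * w' * (1ℤ + correlation P P') ∎
      where
      open ≡-Reasoning
      w = + weight P
      w' = + weight P'
      interchange : ∀ a b c d → (a * b) * (c * d) ≡ (a * c) * (b * d)
      interchange = solve-∀ ℤ-ring
      factor : ∀ a b → a + a * b ≡ a * (1ℤ + b)
      factor = solve-∀ ℤ-ring

    correlation-sym : ∀ P P' → correlation P P' ≡ correlation P' P
    correlation-sym P P' = sum-cong-≗ λ x → ℤ.*-comm (signs P x) (signs P' x)

    gram-sym : ∀ P P' → gram P P' ≡ gram P' P
    gram-sym P P' = sum-cong-≗ λ y → ℤ.*-comm (vector P y) (vector P' y)

    gram-e₀ : ∀ P → ∑[ y < suc n ] (δ zero y * vector P y) ≡ + weight P
    gram-e₀ P = δ-sum zero (vector P)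

    combination : ∀ {k} (r : Fin k → Fin n) (s : Fin k → Bool) (g : Fin n → ℤ) →
                  ∑[ x < n ] (∑[ q < k ] (sgn (s q) * δ (r q) x) * g x) ≡ ∑[ q < k ] (sgn (s q) * g (r q))
    combination {k} r s g = begin
      ∑[ x < n ] (∑[ q < k ] (sgn (s q) * δ (r q) x) * g x)
        ≡⟨ sum-cong-≗ (λ x → *-distribʳ-sum (g x) (λ q → sgn (s q) * δ (r q) x)) ⟩
      ∑[ x < n ] ∑[ q < k ] (sgn (s q) * δ (r q) x * g x)    ≡⟨ ∑-comm (λ x q → sgn (s q) * δ (r q) x * g x) ⟩
      ∑[ q < k ] ∑[ x < n ] (sgn (s q) * δ (r q) x * g x)    ≡⟨ sum-cong-≗ (λ q → pull-out q) ⟩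
      ∑[ q < k ] (sgn (s q) * g (r q))                       ∎
      where
      open ≡-Reasoning
      pull-out : ∀ q → ∑[ x < n ] (sgn (s q) * δ (r q) x * g x) ≡ sgn (s q) * g (r q)
      pull-out q = trans (sum-cong-≗ λ x → ℤ.*-assoc (sgn (s q)) (δ (r q) x) (g x))
                         (trans (sym (*-distribˡ-sum (sgn (s q)) (λ x → δ (r q) x * g x))) (cong (sgn (s q) *_) (δ-sum (r q) g)))

    Assigns : Profile n → Fin n → Bool → Set
    Assigns dead           x b = ⊥
    Assigns fixed          x b = ⊥
    Assigns (single r s)   x b = r ≡ x × s ≡ b
    Assigns (triple r _ s) x b = ∃ λ q → r q ≡ x × s q ≡ b

    Clash : Profile n → Profile n → Set
    Clash P P' = ∃₂ λ x b → Assigns P x b × Assigns P' x (not b)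

    Coherent : Profile n → Profile n → Set
    Coherent (triple r _ s) (triple r' _ s') =
      ∀ {i i' l l'} → i ≢ i' → r i ≡ r' l → r i' ≡ r' l' → r (third i i') ≡ r' (third l l') × xor3 s ≡ xor3 s'
    Coherent _ _ = ⊤

    signs-assigned : ∀ P {x b} → Assigns P x b → signs P x ≡ sgn b
    signs-assigned (single r s) (refl , refl) = trans (cong (sgn s *_) (δ-≡ {a = r} refl)) (ℤ.*-identityʳ (sgn s))
    signs-assigned (triple r r-inj s) (q , refl , refl) =
      trans (sum-single _ q λ q' q'≢q → trans (cong (sgn (s q') *_) (δ-≢ (q'≢q ∘ r-inj))) (ℤ.*-zeroʳ (sgn (s q'))))
            (trans (cong (sgn (s q) *_) (δ-≡ {a = r q} refl)) (ℤ.*-identityʳ (sgn (s q))))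

    signs-unassigned : ∀ P {x} → (∀ b → ¬ Assigns P x b) → signs P x ≡ 0ℤ
    signs-unassigned dead           _ = refl
    signs-unassigned fixed          _ = refl
    signs-unassigned (single r s)   free = trans (cong (sgn s *_) (δ-≢ λ r≡x → free s (r≡x , refl))) (ℤ.*-zeroʳ (sgn s))
    signs-unassigned (triple r _ s) free =
      trans (sum-cong-≗ λ q → trans (cong (sgn (s q) *_) (δ-≢ λ rq≡x → free (s q) (q , rq≡x , refl))) (ℤ.*-zeroʳ (sgn (s q))))
            (sum-replicate-zero 3)

    assigned? : ∀ P x → (∃ λ b → Assigns P x b) ⊎ (∀ b → ¬ Assigns P x b)
    assigned? dead           x = inj₂ λ _ ()
    assigned? fixed          x = inj₂ λ _ ()
    assigned? (single r s)   x with r Fin.≟ x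
    ... | yes r≡x = inj₁ (s , r≡x , refl)
    ... | no  r≢x = inj₂ λ _ (r≡x , _) → r≢x r≡x
    assigned? (triple r _ s) x with Fin.any? (λ q → r q Fin.≟ x)
    ... | yes (q , rq≡x) = inj₁ (s q , q , rq≡x , refl)
    ... | no  none       = inj₂ λ _ (q , rq≡x , _) → none (q , rq≡x)

    signed-δ-sum : ∀ c (r : Fin n) (g : Fin n → ℤ) → ∑[ x < n ] (c * δ r x * g x) ≡ c * g r
    signed-δ-sum c r g = trans (sum-cong-≗ λ x → ℤ.*-assoc c (δ r x) (g x))
                               (trans (sym (*-distribˡ-sum c (λ x → δ r x * g x))) (cong (c *_) (δ-sum r g)))

    correlation-single : ∀ r s (P' : Profile n) → correlation (single r s) P' ≡ sgn s * signs P' r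
    correlation-single r s P' = signed-δ-sum (sgn s) r (signs P')

    correlation-triple : ∀ r (r-inj : Injective _≡_ _≡_ r) s (P' : Profile n) →
                         correlation (triple r r-inj s) P' ≡ ∑[ q < 3 ] (sgn (s q) * signs P' (r q))
    correlation-triple r _ s P' = combination r s (signs P')

    clash-sym : ∀ {P P' : Profile n} → Clash P P' → Clash P' P
    clash-sym {P} (x , b , A , A') = x , not b , A' , subst (Assigns P x) (sym (not-involutive b)) A

    agreement-sym : ∀ {P P' : Profile n} → Vanishing (1ℤ + correlation P' P) (Clash P' P) →
           Vanishing (1ℤ + correlation P P') (Clash P P')
    agreement-sym {P} {P'} V = record
      { nonneg   = subst (λ v → 0ℤ ℤ.≤ 1ℤ + v) (correlation-sym P' P) (Vanishing.nonneg V)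
      ; vanishes = λ C → trans (cong (λ v → 1ℤ + v) (correlation-sym P P')) (Vanishing.vanishes V (clash-sym C)) }

    correlation-silent : ∀ P (P' : Profile n) → (∀ x → signs P x ≡ 0ℤ) → correlation P P' ≡ 0ℤ
    correlation-silent P P' silent =
      trans (sum-cong-≗ λ x → trans (cong (_* signs P' x) (silent x)) (ℤ.*-zeroˡ (signs P' x))) (sum-replicate-zero n)

    silent-agreement : ∀ {P} (P' : Profile n) → (∀ x → signs P x ≡ 0ℤ) → (∀ x b → ¬ Assigns P x b) →
                       Vanishing (1ℤ + correlation P P') (Clash P P')
    silent-agreement {P} P' silent unassigned = record
      { nonneg   = subst (λ v → 0ℤ ℤ.≤ 1ℤ + v) (sym (correlation-silent P P' silent)) (+≤+ ℕ.z≤n)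
      ; vanishes = λ (x , b , A , _) → ⊥-elim (unassigned x b A) }

    single-agreement : ∀ r s (P' : Profile n) → Vanishing (1ℤ + correlation (single r s) P') (Clash (single r s) P')
    single-agreement r s P' = record
      { nonneg   = subst (λ v → 0ℤ ℤ.≤ 1ℤ + v) (sym (correlation-single r s P')) nonneg
      ; vanishes = λ { (x , b , (refl , refl) , A') →
                       trans (cong (λ v → 1ℤ + v) (correlation-single r s P'))
                             (trans (cong (λ z → 1ℤ + sgn s * z) (signs-assigned P' A'))
                                    (Vanishing.vanishes (sign-agreement s (not s)) refl)) } }
      where
      nonneg : 0ℤ ℤ.≤ 1ℤ + sgn s * signs P' r
      nonneg with assigned? P' r
      ... | inj₁ (b , A) = subst (λ z → 0ℤ ℤ.≤ 1ℤ + sgn s * z) (sym (signs-assigned P' A)) (Vanishing.nonneg (sign-agreement s b))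
      ... | inj₂ free    = subst (λ z → 0ℤ ℤ.≤ 1ℤ + sgn s * z) (sym (signs-unassigned P' free))
                                 (subst (λ z → 0ℤ ℤ.≤ 1ℤ + z) (sym (ℤ.*-zeroʳ (sgn s))) (+≤+ ℕ.z≤n))

    module _ {r r' : Fin 3 → Fin n} (r-inj : Injective _≡_ _≡_ r) (r'-inj : Injective _≡_ _≡_ r') (s s' : Fin 3 → Bool) where

      private
        P P' : Profile n
        P  = triple r r-inj s
        P' = triple r' r'-inj s'

      shared-agreement : (π : Fin 3 → Fin 3) → (∀ q → r' (π q) ≡ r q) → xor3 (λ q → s q xor s' (π q)) ≡ false →
                         Vanishing (1ℤ + correlation P P') (Clash P P')
      shared-agreement π rπ parity = record
        { nonneg   = subst (λ v → 0ℤ ℤ.≤ 1ℤ + v) (sym correlation≡) (Vanishing.nonneg V)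
        ; vanishes = λ C → trans (cong (λ v → 1ℤ + v) correlation≡) (Vanishing.vanishes V (clash-parity C)) }
        where
        e : Fin 3 → Bool
        e q = s q xor s' (π q)
        V = parity-agreement (e 0F) (e 1F) (e 2F) parity
        correlation≡ : correlation P P' ≡ ∑[ q < 3 ] sgn (e q)
        correlation≡ = trans (correlation-triple r r-inj s P') (sum-cong-≗ λ q →
          trans (cong (sgn (s q) *_) (signs-assigned P' (π q , rπ q , refl))) (sym (sgn-xor (s q) (s' (π q)))))
        clash-parity : Clash P P' → e 0F ∨ e 1F ∨ e 2F ≡ true
        clash-parity (x , b , (q , rq≡x , sq≡b) , (l , r'l≡x , s'l≡¬b)) =
          some-true e q (trans (cong₂ _xor_ sq≡b (trans (cong s' πq≡l) s'l≡¬b)) (xor-not b))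
          where
          πq≡l : π q ≡ l
          πq≡l = r'-inj (trans (rπ q) (trans rq≡x (sym r'l≡x)))
          xor-not : ∀ b → b xor not b ≡ true
          xor-not false = refl
          xor-not true  = refl

      lonely-agreement : ∀ q₀ → (∀ q → q ≢ q₀ → ∀ l → r' l ≢ r q) → Vanishing (1ℤ + correlation P P') (Clash P P')
      lonely-agreement q₀ lonely = record
        { nonneg   = subst (λ v → 0ℤ ℤ.≤ 1ℤ + v) (sym correlation≡) (Vanishing.nonneg V)
        ; vanishes = λ C → trans (cong (λ v → 1ℤ + v) correlation≡) (Vanishing.vanishes V (clash-at-q₀ C)) }
        where
        V = single-agreement (r q₀) (s q₀) P'
        correlation≡ : correlation P P' ≡ correlation (single (r q₀) (s q₀)) P'
        correlation≡ = trans (correlation-triple r r-inj s P') (trans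
          (sum-single _ q₀ λ q q≢q₀ →
            trans (cong (sgn (s q) *_) (signs-unassigned P' λ _ (l , r'l≡rq , _) → lonely q q≢q₀ l r'l≡rq))
                  (ℤ.*-zeroʳ (sgn (s q))))
          (sym (correlation-single (r q₀) (s q₀) P')))
        clash-at-q₀ : Clash P P' → Clash (single (r q₀) (s q₀)) P'
        clash-at-q₀ (x , b , (q , rq≡x , sq≡b) , A'@(l , r'l≡x , _)) with q Fin.≟ q₀
        ... | yes refl = x , b , (rq≡x , sq≡b) , A'
        ... | no  q≢q₀ = ⊥-elim (lonely q q≢q₀ l (trans r'l≡x (sym rq≡x)))

      triple-agreement : Coherent P P' → Vanishing (1ℤ + correlation P P') (Clash P P')
      triple-agreement coh with matched (r 0F) | matched (r 1F) | matched (r 2F)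
        where
        matched : ∀ x → (∃ λ l → r' l ≡ x) ⊎ (∀ l → r' l ≢ x)
        matched x with Fin.any? (λ l → r' l Fin.≟ x)
        ... | yes found = inj₁ found
        ... | no  none  = inj₂ λ l r'l≡x → none (l , r'l≡x)
      ... | inj₁ (l₀ , e₀) | inj₁ (l₁ , e₁) | _ = shared-agreement π rπ parity
        where
        l₀≢l₁ : l₀ ≢ l₁
        l₀≢l₁ refl with r-inj (trans (sym e₀) e₁)
        ... | ()
        shared = coh {0F} {1F} (λ ()) (sym e₀) (sym e₁)
        π : Fin 3 → Fin 3
        π 0F = l₀
        π 1F = l₁
        π 2F = third l₀ l₁
        rπ : ∀ q → r' (π q) ≡ r q
        rπ 0F = e₀
        rπ 1F = e₁
        rπ 2F = sym (proj₁ shared)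
        parity : xor3 (λ q → s q xor s' (π q)) ≡ false
        parity = begin
          xor3 (λ q → s q xor s' (π q))   ≡⟨ split (s 0F) (s 1F) (s 2F) (s' l₀) (s' l₁) (s' (third l₀ l₁)) ⟩
          xor3 s xor xor3 (s' ∘ π)         ≡⟨ cong₂ _xor_ (proj₂ shared) (sym (xor3-third s' l₀≢l₁)) ⟩
          xor3 s' xor xor3 s'              ≡⟨ xor-same (xor3 s') ⟩
          false                            ∎
          where
          open ≡-Reasoning
          split : ∀ a b c a' b' c' → (a xor a') xor ((b xor b') xor (c xor c')) ≡ (a xor (b xor c)) xor (a' xor (b' xor c'))
          split = solve-∀ xor-ring
      ... | inj₁ (l₀ , e₀) | inj₂ none₁ | inj₁ (l₂ , e₂) =
        ⊥-elim (none₁ _ (sym (proj₁ (coh {0F} {2F} (λ ()) (sym e₀) (sym e₂)))))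
      ... | inj₂ none₀ | inj₁ (l₁ , e₁) | inj₁ (l₂ , e₂) =
        ⊥-elim (none₀ _ (sym (proj₁ (coh {1F} {2F} (λ ()) (sym e₁) (sym e₂)))))
      ... | inj₁ _ | inj₂ none₁ | inj₂ none₂ =
        lonely-agreement 0F λ { 0F 0≢0 → ⊥-elim (0≢0 refl) ; 1F _ → none₁ ; 2F _ → none₂ }
      ... | inj₂ none₀ | inj₁ _ | inj₂ none₂ =
        lonely-agreement 1F λ { 0F _ → none₀ ; 1F 1≢1 → ⊥-elim (1≢1 refl) ; 2F _ → none₂ }
      ... | inj₂ none₀ | inj₂ none₁ | _ =
        lonely-agreement 2F λ { 0F _ → none₀ ; 1F _ → none₁ ; 2F 2≢2 → ⊥-elim (2≢2 refl) }

    agreement : ∀ P P' → Coherent P P' → Vanishing (1ℤ + correlation P P') (Clash P P')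
    agreement dead               P'  _ = silent-agreement {dead} P' (λ _ → refl) λ _ _ ()
    agreement fixed              P'  _ = silent-agreement {fixed} P' (λ _ → refl) λ _ _ ()
    agreement (single r s)       P'  _ = single-agreement r s P'
    agreement P@(triple _ _ _)   dead          _ = agreement-sym {P} {dead} (silent-agreement {dead} P (λ _ → refl) λ _ _ ())
    agreement P@(triple _ _ _)   fixed         _ = agreement-sym {P} {fixed} (silent-agreement {fixed} P (λ _ → refl) λ _ _ ())
    agreement P@(triple _ _ _)   (single r' s') _ = agreement-sym {P} {single r' s'} (single-agreement r' s' P)
    agreement (triple _ r-inj s) (triple _ r'-inj s') coh = triple-agreement r-inj r'-inj s s' coh

    gram-agreement : ∀ P P' → Coherent P P' → Vanishing (gram P P') (Clash P P')
    gram-agreement P P' coh = record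
      { nonneg   = subst (0ℤ ℤ.≤_) (sym (gram-correlation P P')) (scaled-nonneg (Vanishing.nonneg V))
      ; vanishes = λ C → trans (gram-correlation P P')
                               (trans (cong (+ weight P * + weight P' *_) (Vanishing.vanishes V C)) (ℤ.*-zeroʳ (+ weight P * + weight P'))) }
      where
      V = agreement P P' coh
      scaled-nonneg : ∀ {v} → 0ℤ ℤ.≤ v → 0ℤ ℤ.≤ + weight P * + weight P' * v
      scaled-nonneg {+ k} _ = subst (0ℤ ℤ.≤_) (trans (ℤ.pos-* (weight P ℕ.* weight P') k)
                                                     (cong (_* + k) (ℤ.pos-* (weight P) (weight P')))) (+≤+ ℕ.z≤n)

    gram-dead : ∀ (P : Profile n) → gram dead P ≡ 0ℤ
    gram-dead P = gram-correlation dead P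

    gram-self : ∀ P → gram P P ≡ + 4 * + weight P
    gram-self P = trans (gram-correlation P P) (self P)
      where
      sgn² : ∀ b → sgn b * sgn b ≡ 1ℤ
      sgn² false = refl
      sgn² true  = refl
      self : ∀ P → + weight P * + weight P * (1ℤ + correlation P P) ≡ + 4 * + weight P
      self dead = refl
      self fixed = cong (λ v → + 16 * (1ℤ + v)) (correlation-silent fixed fixed λ _ → refl)
      self (single r s) = cong (λ v → + 4 * (1ℤ + v)) (trans (correlation-single r s (single r s))
        (trans (cong (sgn s *_) (signs-assigned (single r s) (refl , refl))) (sgn² s)))
      self P@(triple r r-inj s) = cong (λ v → + 1 * (1ℤ + v)) (trans (correlation-triple r r-inj s P)
        (sum-cong-≗ {3} {y = λ _ → 1ℤ} λ q → trans (cong (sgn (s q) *_) (signs-assigned P (q , refl , refl))) (sgn² (s q))))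

-- The width-two closure of a formula under GE3

module Formula {n m : ℕ} (φ : CNF3 n m) (unrefuted : ¬ GE3Refutes φ) where
  open import Data.Nat using (_≤_; _<_)

  clauseVar : Fin m → Fin 3 → Fin n
  clauseVar j p = var (lit (φ j) p)

  Derived : Form n → Bool → Set
  Derived f c = GE3Derivable φ (tabulate f , c) ⊎ (f ≗ 𝟎 × c ≡ false)

  derived-cong : ∀ {f g c} → f ≗ g → Derived f c → Derived g c
  derived-cong {c = c} f≗g (inj₁ d) = inj₁ (subst (λ v → GE3Derivable φ (v , c)) (tabulate-cong f≗g) d)
  derived-cong f≗g (inj₂ (f≗𝟎 , c≡false)) = inj₂ ((λ i → trans (sym (f≗g i)) (f≗𝟎 i)) , c≡false)

  derived-add : ∀ {f g c d} → Derived f c → Derived g d → width (f ⊕ g) ≤ 3 → Derived (f ⊕ g) (c xor d)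
  derived-add {f} {g} {c} {d} (inj₁ x) (inj₁ y) w≤3 =
    inj₁ (subst (λ v → GE3Derivable φ (v , c xor d)) (tabulate-⊕ f g)
           (add x y (subst (_≤ 3) (sym (trans (cong ∣_∣ (tabulate-⊕ f g)) (∣tabulate∣≡width (f ⊕ g)))) w≤3)))
  derived-add (inj₂ (f≗𝟎 , refl)) y _ = derived-cong (λ i → cong (_xor _) (sym (f≗𝟎 i))) y
  derived-add {f} {c = c} x (inj₂ (g≗𝟎 , refl)) _ =
    subst (Derived _) (sym (xor-identityʳ c))
          (derived-cong (λ i → trans (sym (xor-identityʳ (f i))) (cong (f i xor_) (sym (g≗𝟎 i)))) x)

  derived-sum : ∀ {f g h c d} → Derived f c → Derived g d → f ⊕ g ≗ h → width h ≤ 3 → Derived h (c xor d)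
  derived-sum x y sum≗h w≤3 = derived-cong sum≗h (derived-add x y (subst (_≤ 3) (sym (width-cong sum≗h)) w≤3))

  consistent : ∀ {f c} → Derived f c → f ≗ 𝟎 → c ≡ false
  consistent {c = false} _ _ = refl
  consistent {f} {true} (inj₁ d) f≗𝟎 =
    ⊥-elim (unrefuted (subst (λ v → GE3Derivable φ (v , true)) (trans (tabulate-cong f≗𝟎) tabulate-𝟎) d))
  consistent {c = true} (inj₂ (_ , ())) _

  -- A union–find structure: x + rep x = shift x is derivable, where rep x is the constant (zero) or
  -- a root r (suc r, with rep r ≡ suc r).
  record Substitution : Set where
    field
      rep         : Fin n → Fin (suc n)
      shift       : Fin n → Bool
      rep-derived : ∀ x → Derived (form (suc x) ⊕ form (rep x)) (shift x)
      rep-root    : ∀ x r → rep x ≡ suc r → rep r ≡ suc r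

    term : Fin m → Fin 3 → Fin (suc n)
    term j p = rep (clauseVar j p)

    reduced : Fin m → Form n
    reduced j x = xor3 λ p → form (term j p) x

    offset : Fin m → Fin 3 → Bool
    offset j p = neg (lit (φ j) p) xor shift (clauseVar j p)

    κ : Fin m → Bool
    κ j = true xor xor3 (offset j)

    reduced-derived : ∀ j → Derived (reduced j) (κ j)
    reduced-derived j = subst (Derived (reduced j)) (constant (neg ∘ lit (φ j)) (shift ∘ clauseVar j)) step₃
      where
      x₀ = clauseVar j 0F
      x₁ = clauseVar j 1F
      x₂ = clauseVar j 2F
      t₀ = term j 0F
      t₁ = term j 1F
      t₂ = term j 2F
      substitute₀ : ∀ a b c t → (a xor (b xor c)) xor (a xor t) ≡ t xor (b xor c)
      substitute₀ = solve-∀ xor-ring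
      substitute₁ : ∀ a b c t → (a xor (b xor c)) xor (b xor t) ≡ a xor (t xor c)
      substitute₁ = solve-∀ xor-ring
      substitute₂ : ∀ a b c t → (a xor (b xor c)) xor (c xor t) ≡ a xor (b xor t)
      substitute₂ = solve-∀ xor-ring
      step₁ = derived-sum (inj₁ (given j)) (rep-derived x₀)
                (λ i → substitute₀ (form (suc x₀) i) (form (suc x₁) i) (form (suc x₂) i) (form t₀ i))
                (width₃ t₀ (suc x₁) (suc x₂))
      step₂ = derived-sum step₁ (rep-derived x₁)
                (λ i → substitute₁ (form t₀ i) (form (suc x₁) i) (form (suc x₂) i) (form t₁ i)) (width₃ t₀ t₁ (suc x₂))
      step₃ = derived-sum step₂ (rep-derived x₂)
                (λ i → substitute₂ (form t₀ i) (form t₁ i) (form (suc x₂) i) (form t₂ i)) (width₃ t₀ t₁ t₂)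
      constant : ∀ (ng sh : Fin 3 → Bool) →
                 (((true xor xor3 ng) xor sh 0F) xor sh 1F) xor sh 2F ≡ true xor xor3 (λ p → ng p xor sh p)
      constant ng sh = regroup (ng 0F) (ng 1F) (ng 2F) (sh 0F) (sh 1F) (sh 2F)
        where
        regroup : ∀ a b c a' b' c' → (((true xor (a xor (b xor c))) xor a') xor b') xor c' ≡
                                      true xor ((a xor a') xor ((b xor b') xor (c xor c')))
        regroup = solve-∀ xor-ring

  module _ (S : Substitution) where
    open Substitution S

    ClauseClosed : Fin m → Set
    ClauseClosed j = width (reduced j) ≤ 2 → reduced j ≗ 𝟎

    PairClosed : Fin m → Fin m → Set
    PairClosed j k = width (reduced j ⊕ reduced k) ≤ 2 → reduced j ≗ reduced k

    record Closed : Set where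
      field
        clause-closed : ∀ j → ClauseClosed j
        pair-closed   : ∀ j k → PairClosed j k

    record Merge : Set where
      field
        root        : Fin n
        root-root   : rep root ≡ suc root
        target      : Fin (suc n)
        target≢root : target ≢ suc root
        target-root : ∀ r → target ≡ suc r → rep r ≡ suc r
        constant    : Bool
        derived     : Derived (form (suc root) ⊕ form target) constant

    reduced-roots : ∀ j x → reduced j x ≡ true → rep x ≡ suc x
    reduced-roots j x r≡true with xor-true (form (term j 0F) x) _ r≡true
    ... | inj₁ t₀ = rep-root _ x (form-true _ x t₀)
    ... | inj₂ t₁₂ with xor-true (form (term j 1F) x) _ t₁₂
    ...   | inj₁ t₁ = rep-root _ x (form-true _ x t₁)
    ...   | inj₂ t₂ = rep-root _ x (form-true _ x t₂)

    merge-from : ∀ {f c} → Derived f c → width f ≤ 2 → (∀ x → f x ≡ true → rep x ≡ suc x) →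
                 ∀ a → f a ≡ true → Merge
    merge-from {f} {c} d w≤2 roots a fa = build (width≤2⇒form⊕form f a w≤2 fa)
      where
      build : (∃ λ t → f ≗ form (suc a) ⊕ form t) → Merge
      build (t , f≗) = record
        { root = a ; root-root = roots a fa ; target = t ; target≢root = t≢a
        ; target-root = λ r t≡r → roots r (fr≡true r t≡r)
        ; constant = c ; derived = derived-cong f≗ d }
        where
        t≢a : t ≢ suc a
        t≢a refl with () ← trans (sym fa) (trans (f≗ a) (xor-same (form (suc a) a)))
        fr≡true : ∀ r → t ≡ suc r → f r ≡ true
        fr≡true r refl = trans (f≗ r) (cong₂ _xor_ (dec-false (a Fin.≟ r) λ a≡r → t≢a (cong suc (sym a≡r))) (form-self r))

    trivial-or-merge : ∀ {f c} → Derived f c → (∀ x → f x ≡ true → rep x ≡ suc x) → (width f ≤ 2 → f ≗ 𝟎) ⊎ Merge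
    trivial-or-merge {f} d roots with width f ℕ.≤? 2
    ... | no  big   = inj₁ λ small → ⊥-elim (big small)
    ... | yes small with Fin.any? (λ x → f x Data.Bool.≟ true)
    ...   | yes (a , fa) = inj₂ (merge-from d small roots a fa)
    ...   | no  none     = inj₁ λ _ x → not-true λ fx → none (x , fx)
      where
      not-true : ∀ {b} → ¬ b ≡ true → b ≡ false
      not-true {false} _ = refl
      not-true {true} b≢true = ⊥-elim (b≢true refl)

    clause-check : ∀ j → ClauseClosed j ⊎ Merge
    clause-check j = trivial-or-merge (reduced-derived j) (reduced-roots j)

    pair-check : ∀ j k → PairClosed j k ⊎ Merge
    pair-check j k with width (reduced j ⊕ reduced k) ℕ.≤? 2
    ... | no  big   = inj₁ λ small → ⊥-elim (big small)
    ... | yes small = Sum.map (λ trivial _ x → xor-≡ (reduced j x) (reduced k x) (trivial small x)) id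
                              (trivial-or-merge (derived-add (reduced-derived j) (reduced-derived k) (ℕ.m≤n⇒m≤1+n small)) roots)
      where
      roots : ∀ x → (reduced j ⊕ reduced k) x ≡ true → rep x ≡ suc x
      roots x jk≡true = [ reduced-roots j x , reduced-roots k x ]′ (xor-true _ _ jk≡true)

    closed-or-merge : Closed ⊎ Merge
    closed-or-merge =
      [ (λ clause-closed → Sum.map (λ pair-closed → record { clause-closed = clause-closed ; pair-closed = pair-closed }) id
                                   (search {P = λ j → ∀ k → PairClosed j k} λ j → search {P = PairClosed j} (pair-check j)))
      , inj₂ ]′ (search {P = ClauseClosed} clause-check)

  roots : Substitution → Form n
  roots S x = does (Substitution.rep S x Fin.≟ suc x)

  module Merging (S : Substitution) (M : Merge S) where
    open Substitution S
    open Merge M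

    redirect : (t : Fin (suc n)) → Dec (t ≡ suc root) → Fin (suc n)
    redirect t (yes _) = target
    redirect t (no  _) = t

    reshift : ∀ x → Dec (rep x ≡ suc root) → Bool
    reshift x (yes _) = shift x xor constant
    reshift x (no  _) = shift x

    redirect-derived : ∀ x d → Derived (form (suc x) ⊕ form (redirect (rep x) d)) (reshift x d)
    redirect-derived x (yes x→root) =
      derived-sum {form (suc x) ⊕ form (suc root)} {form (suc root) ⊕ form target} {form (suc x) ⊕ form target} {shift x} {constant}
        (subst (λ t → Derived (form (suc x) ⊕ form t) (shift x)) x→root (rep-derived x)) derived
        (λ i → chain (form (suc x) i) (form (suc root) i) (form target i))
        (ℕ.≤-trans (width₂ (suc x) target) (ℕ.n≤1+n 2))
      where
      chain : ∀ a b c → (a xor b) xor (b xor c) ≡ a xor c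
      chain = solve-∀ xor-ring
    redirect-derived x (no _) = rep-derived x

    redirect-root : ∀ x r (dx : Dec (rep x ≡ suc root)) (dr : Dec (rep r ≡ suc root)) →
                    redirect (rep x) dx ≡ suc r → redirect (rep r) dr ≡ suc r
    redirect-root x r (yes _)      (yes r→root) t≡r = ⊥-elim (target≢root (trans t≡r (trans (sym (target-root r t≡r)) r→root)))
    redirect-root x r (yes _)      (no  _)      t≡r = target-root r t≡r
    redirect-root x r (no  x↛root) (yes r→root) x→r = ⊥-elim (x↛root (trans x→r (trans (sym (rep-root x r x→r)) r→root)))
    redirect-root x r (no  _)      (no  _)      x→r = rep-root x r x→r

    merged : Substitution
    merged = record
      { rep = λ x → redirect (rep x) (rep x Fin.≟ suc root)
      ; shift = λ x → reshift x (rep x Fin.≟ suc root)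
      ; rep-derived = λ x → redirect-derived x (rep x Fin.≟ suc root)
      ; rep-root = λ x r → redirect-root x r (rep x Fin.≟ suc root) (rep r Fin.≟ suc root) }

    merged-shrinks : width (roots merged) < width (roots S)
    merged-shrinks =
      width-mono-< (roots merged) (roots S) kept root (gone (rep root Fin.≟ suc root)) (dec-true (rep root Fin.≟ suc root) root-root)
      where
      true⇒ : ∀ {P : Set} (d : Dec P) → does d ≡ true → P
      true⇒ (yes p) _ = p
      still-root : ∀ x (d : Dec (rep x ≡ suc root)) → redirect (rep x) d ≡ suc x → rep x ≡ suc x
      still-root x (yes _) t≡x = target-root x t≡x
      still-root x (no  _) x→x = x→x
      kept : ∀ x → roots merged x ≡ true → roots S x ≡ true
      kept x root' = dec-true (rep x Fin.≟ suc x)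
        (still-root x (rep x Fin.≟ suc root) (true⇒ (redirect (rep x) (rep x Fin.≟ suc root) Fin.≟ suc x) root'))
      gone : (d : Dec (rep root ≡ suc root)) → does (redirect (rep root) d Fin.≟ suc root) ≡ false
      gone (yes _)        = dec-false (target Fin.≟ suc root) target≢root
      gone (no  root↛root) = ⊥-elim (root↛root root-root)

  close : ∀ k (S : Substitution) → width (roots S) < k → Σ Substitution Closed
  close (suc k) S (s≤s small) =
    [ (λ closed → S , closed)
    , (λ M → close k (Merging.merged S M) (ℕ.≤-trans (Merging.merged-shrinks S M) small)) ]′ (closed-or-merge S)

  initial : Substitution
  initial = record
    { rep = suc ; shift = λ _ → false
    ; rep-derived = λ x → inj₂ ((λ i → xor-same (form (suc x) i)) , refl)
    ; rep-root = λ _ _ _ → refl }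

  closure : Σ Substitution Closed
  closure = close (suc n) initial (s≤s (width≤n (roots initial)))

module _ where
  open import Data.Nat using (_≤_)

  data Shape {n} (t : Fin 3 → Fin (suc n)) : Set where
    triple : (r : Fin 3 → Fin n) → (∀ p → t p ≡ suc (r p)) → Injective _≡_ _≡_ r → Shape t
    double : ∀ {i i'} → i ≢ i' → (r : Fin n) → t i ≡ suc r → t i' ≡ suc r → t (third i i') ≡ zero → Shape t
    fixed  : (∀ p → t p ≡ zero) → Shape t

  xorForm : ∀ {n} → (Fin 3 → Fin (suc n)) → Form n
  xorForm t x = xor3 λ p → form (t p) x

  classify : ∀ {n} (t : Fin 3 → Fin (suc n)) → (width (xorForm t) ≤ 2 → xorForm t ≗ 𝟎) → Shape t
  classify {n} t closed = go (t 0F) (t 1F) (t 2F) refl refl refl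
    where
    as : ∀ {a b c} → t 0F ≡ a → t 1F ≡ b → t 2F ≡ c → ∀ x → xorForm t x ≡ form a x xor (form b x xor form c x)
    as refl refl refl x = refl
    ¬one-variable : ∀ c → xorForm t ≗ form (suc c) → ⊥
    ¬one-variable c t≗c
      with trans (sym (closed (subst (_≤ 2) (sym (width-cong t≗c)) (ℕ.≤-trans (width-form (suc c)) (ℕ.n≤1+n 1))) c))
                 (trans (t≗c c) (form-self c))
    ... | ()
    pair-true : ∀ {a b} → a ≢ b → form (suc a) a xor form (suc b) a ≡ true
    pair-true {a} {b} a≢b = cong₂ _xor_ (form-self a) (dec-false (b Fin.≟ a) (a≢b ∘ sym))
    ¬two-variables : ∀ {a b} → a ≢ b → xorForm t ≗ form (suc a) ⊕ form (suc b) → ⊥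
    ¬two-variables {a} {b} a≢b t≗ab
      with trans (sym (closed (subst (_≤ 2) (sym (width-cong t≗ab)) (width₂ (suc a) (suc b))) a)) (trans (t≗ab a) (pair-true a≢b))
    ... | ()
    cancel₀₁ : ∀ a c → a xor (a xor c) ≡ c
    cancel₀₁ = solve-∀ xor-ring
    cancel₀₂ : ∀ a b → a xor (b xor a) ≡ b
    cancel₀₂ = solve-∀ xor-ring
    cancel₁₂ : ∀ a b → a xor (b xor b) ≡ a
    cancel₁₂ = solve-∀ xor-ring
    go : ∀ a b c → t 0F ≡ a → t 1F ≡ b → t 2F ≡ c → Shape t
    go zero    zero    zero    e₀ e₁ e₂ = fixed λ { 0F → e₀ ; 1F → e₁ ; 2F → e₂ }
    go zero    zero    (suc c) e₀ e₁ e₂ = ⊥-elim (¬one-variable c (as e₀ e₁ e₂))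
    go zero    (suc c) zero    e₀ e₁ e₂ = ⊥-elim (¬one-variable c λ x → trans (as e₀ e₁ e₂ x) (xor-identityʳ _))
    go (suc c) zero    zero    e₀ e₁ e₂ = ⊥-elim (¬one-variable c λ x → trans (as e₀ e₁ e₂ x) (xor-identityʳ _))
    go zero    (suc a) (suc b) e₀ e₁ e₂ with a Fin.≟ b
    ... | yes refl = double {i = 1F} {2F} (λ ()) a e₁ e₂ e₀
    ... | no  a≢b  = ⊥-elim (¬two-variables a≢b (as e₀ e₁ e₂))
    go (suc a) zero    (suc b) e₀ e₁ e₂ with a Fin.≟ b
    ... | yes refl = double {i = 0F} {2F} (λ ()) a e₀ e₂ e₁
    ... | no  a≢b  = ⊥-elim (¬two-variables a≢b (as e₀ e₁ e₂))
    go (suc a) (suc b) zero    e₀ e₁ e₂ with a Fin.≟ b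
    ... | yes refl = double {i = 0F} {1F} (λ ()) a e₀ e₁ e₂
    ... | no  a≢b  = ⊥-elim (¬two-variables a≢b λ x → trans (as e₀ e₁ e₂ x) (cong (form (suc a) x xor_) (xor-identityʳ _)))
    go (suc a) (suc b) (suc c) e₀ e₁ e₂ with a Fin.≟ b | a Fin.≟ c | b Fin.≟ c
    ... | yes refl | _        | _        =
      ⊥-elim (¬one-variable c λ x → trans (as e₀ e₁ e₂ x) (cancel₀₁ (form (suc a) x) (form (suc c) x)))
    ... | no  _    | yes refl | _        =
      ⊥-elim (¬one-variable b λ x → trans (as e₀ e₁ e₂ x) (cancel₀₂ (form (suc a) x) (form (suc b) x)))
    ... | no  _    | no  _    | yes refl =
      ⊥-elim (¬one-variable a λ x → trans (as e₀ e₁ e₂ x) (cancel₁₂ (form (suc a) x) (form (suc b) x)))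
    ... | no  a≢b  | no  a≢c  | no  b≢c  = triple r (λ { 0F → e₀ ; 1F → e₁ ; 2F → e₂ }) r-injective
      where
      r : Fin 3 → Fin n
      r 0F = a
      r 1F = b
      r 2F = c
      r-injective : Injective _≡_ _≡_ r
      r-injective {0F} {0F} _ = refl
      r-injective {0F} {1F} a≡b = ⊥-elim (a≢b a≡b)
      r-injective {0F} {2F} a≡c = ⊥-elim (a≢c a≡c)
      r-injective {1F} {0F} b≡a = ⊥-elim (a≢b (sym b≡a))
      r-injective {1F} {1F} _ = refl
      r-injective {1F} {2F} b≡c = ⊥-elim (b≢c b≡c)
      r-injective {2F} {0F} c≡a = ⊥-elim (a≢c (sym c≡a))
      r-injective {2F} {1F} c≡b = ⊥-elim (b≢c (sym c≡b))
      r-injective {2F} {2F} _ = refl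

module _ where
  open ℤ∑ using (sum; sum-syntax)

  -- each literal is true in exactly two of the four odd assignments
  two-of-four : ∀ p c → ∑[ a < 4 ] (+ (if oddAssignment a p xor c then 0 else 2)) ≡ + 4
  two-of-four 0F false = refl
  two-of-four 0F true  = refl
  two-of-four 1F false = refl
  two-of-four 1F true  = refl
  two-of-four 2F false = refl
  two-of-four 2F true  = refl

  -- when c is odd, exactly one odd assignment equals c
  one-of-four : ∀ c₀ c₁ c₂ → c₀ xor (c₁ xor c₂) ≡ true →
    ∑[ a < 4 ] (+ (if (oddAssignment a 0F xor c₀) ∨ (oddAssignment a 1F xor c₁) ∨ (oddAssignment a 2F xor c₂) then 0 else 4)) ≡ + 4
  one-of-four false false true  _ = refl
  one-of-four false true  false _ = refl
  one-of-four true  false false _ = refl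
  one-of-four true  true  true  _ = refl
  one-of-four false false false ()
  one-of-four false true  true  ()
  one-of-four true  false true  ()
  one-of-four true  true  false ()

module Vertices {n m : ℕ} {φ : CNF3 n m} {unrefuted : ¬ GE3Refutes φ}
               (S : Formula.Substitution φ unrefuted) (closed : Formula.Closed φ unrefuted S) where
  open Formula φ unrefuted
  open Substitution S
  open Closed closed
  open ℤ∑ using (sum; sum-syntax; sum-cong-≗)
  open import Data.Nat using (_≤_)

  -- the value that vertex (j , a) gives to the atom term j p
  value : Fin m → Fin 4 → Fin 3 → Bool
  value j a p = oddAssignment a p xor offset j p

  value-parity : ∀ j a → xor3 (value j a) ≡ κ j
  value-parity j a = trans (split (oddAssignment a 0F) (oddAssignment a 1F) (oddAssignment a 2F) (offset j 0F) (offset j 1F) (offset j 2F))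
                           (cong (_xor xor3 (offset j)) (xor3-odd a))
    where
    split : ∀ a b c a' b' c' → (a xor a') xor ((b xor b') xor (c xor c')) ≡ (a xor (b xor c)) xor (a' xor (b' xor c'))
    split = solve-∀ xor-ring

  κ-trivial : ∀ j → reduced j ≗ 𝟎 → κ j ≡ false
  κ-trivial j = consistent (reduced-derived j)

  κ-equal : ∀ j k → reduced j ≗ reduced k → κ j ≡ κ k
  κ-equal j k j≗k = xor-≡ (κ j) (κ k) (consistent (derived-add (reduced-derived j) (reduced-derived k) width≤3) sum≗𝟎)
    where
    sum≗𝟎 : reduced j ⊕ reduced k ≗ 𝟎
    sum≗𝟎 x = trans (cong (_xor reduced k x) (j≗k x)) (xor-same (reduced k x))
    width≤3 : width (reduced j ⊕ reduced k) ≤ 3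
    width≤3 = subst (_≤ 3) (sym (trans (width-cong sum≗𝟎) (width-𝟎 {n}))) z≤n

  shape : ∀ j → Shape (term j)
  shape j = classify (term j) (clause-closed j)

  double-κ : ∀ {j i i'} → i ≢ i' → ∀ r → term j i ≡ suc r → term j i' ≡ suc r → term j (third i i') ≡ zero →
             κ j ≡ false
  double-κ {j} {i} {i'} i≢i' r tᵢ tᵢ' t₃ = κ-trivial j λ x →
    trans (xor3-third (λ p → form (term j p) x) i≢i')
          (trans (cong₂ (λ u v → form u x xor (form u' x xor form v x)) tᵢ t₃)
                 (trans (cong (λ u → form (suc r) x xor (form u x xor false)) tᵢ') (cancel (form (suc r) x))))
    where
    u' = term j i'
    cancel : ∀ a → a xor (a xor false) ≡ false
    cancel = solve-∀ xor-ring

  fixed-κ : ∀ {j} → (∀ p → term j p ≡ zero) → κ j ≡ false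
  fixed-κ {j} t≡0 = κ-trivial j λ x →
    trans (cong₂ (λ u v → form u x xor (form v x xor form (term j 2F) x)) (t≡0 0F) (t≡0 1F))
          (cong (λ u → false xor (false xor form u x)) (t≡0 2F))

  profileOf : ∀ {j} → Shape (term j) → Fin 4 → Profile n
  profileOf {j} (triple r _ r-inj)          a = triple r r-inj (value j a)
  profileOf {j} (double {i} {i'} _ r _ _ _) a = if value j a (third i i') then dead else single r (value j a i)
  profileOf {j} (fixed _)                   a = if value j a 0F ∨ value j a 1F ∨ value j a 2F then dead else fixed

  weight-if : ∀ b (P : Profile n) → weight (if b then dead else P) ≡ (if b then 0 else weight P)
  weight-if true  P = refl
  weight-if false P = refl

  weights : ∀ {j} (sh : Shape (term j)) → ∑[ a < 4 ] (+ weight (profileOf sh a)) ≡ + 4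
  weights (triple _ _ _) = refl
  weights {j} (double {i} {i'} _ r _ _ _) = trans (sum-cong-≗ λ a → cong +_ (weight-if (value j a (third i i')) (single r (value j a i))))
                                                  (two-of-four (third i i') (offset j (third i i')))
  weights {j} (fixed t≡0) = trans (sum-cong-≗ λ a → cong +_ (weight-if (value j a 0F ∨ value j a 1F ∨ value j a 2F) fixed))
                                  (one-of-four (offset j 0F) (offset j 1F) (offset j 2F) odd-offset)
    where
    odd-offset : xor3 (offset j) ≡ true
    odd-offset = trans (sym (not-involutive _)) (cong not (fixed-κ t≡0))

  assigns-root : ∀ {j} (sh : Shape (term j)) a p {r} → term j p ≡ suc r →
                 profileOf sh a ≡ dead ⊎ Assigns (profileOf sh a) r (value j a p)
  assigns-root (triple r t≡r _) a p tp≡r = inj₂ (p , Fin.suc-injective (trans (sym (t≡r p)) tp≡r) , refl)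
  assigns-root {j} (double {i} {i'} i≢i' r tᵢ tᵢ' t₃) a p {r'} tp≡r' with value j a (third i i') in v₃
  ... | true  = inj₁ refl
  ... | false with third-cases i i' i≢i' p
  ...   | inj₁ refl = inj₂ (Fin.suc-injective (trans (sym tᵢ) tp≡r') , refl)
  ...   | inj₂ (inj₁ refl) = inj₂ (Fin.suc-injective (trans (sym tᵢ') tp≡r') , vᵢ≡vᵢ')
    where
    vᵢ≡vᵢ' : value j a i ≡ value j a i'
    vᵢ≡vᵢ' = equal (value j a i) (value j a i') (trans (sym (cong (λ v → value j a i xor (value j a i' xor v)) v₃))
               (trans (sym (xor3-third (value j a) i≢i')) (trans (value-parity j a) (double-κ i≢i' r tᵢ tᵢ' t₃))))
      where
      equal : ∀ u v → u xor (v xor false) ≡ false → u ≡ v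
      equal false false _ = refl
      equal true  true  _ = refl
  ...   | inj₂ (inj₂ refl) with () ← trans (sym t₃) tp≡r'
  assigns-root (fixed t≡0) a p tp≡r with () ← trans (sym (t≡0 p)) tp≡r

  fixed-false : ∀ {j} (sh : Shape (term j)) a p → term j p ≡ zero → profileOf sh a ≡ dead ⊎ value j a p ≡ false
  fixed-false (triple r t≡r _) a p tp≡0 with () ← trans (sym (t≡r p)) tp≡0
  fixed-false {j} (double {i} {i'} i≢i' r tᵢ tᵢ' t₃) a p tp≡0 with value j a (third i i') in v₃
  ... | true  = inj₁ refl
  ... | false with third-cases i i' i≢i' p
  ...   | inj₁ refl with () ← trans (sym tᵢ) tp≡0
  ...   | inj₂ (inj₁ refl) with () ← trans (sym tᵢ') tp≡0
  ...   | inj₂ (inj₂ refl) = inj₂ v₃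
  fixed-false {j} (fixed _) a p _ with value j a 0F in v₀ | value j a 1F in v₁ | value j a 2F in v₂
  ... | true  | _     | _     = inj₁ refl
  ... | false | true  | _     = inj₁ refl
  ... | false | false | true  = inj₁ refl
  ... | false | false | false = inj₂ (all-false p)
    where
    all-false : ∀ p → value j a p ≡ false
    all-false 0F = v₀
    all-false 1F = v₁
    all-false 2F = v₂

  profile : Fin m → Fin 4 → Profile n
  profile j = profileOf (shape j)

  coherent : ∀ {j k} (shj : Shape (term j)) (shk : Shape (term k)) a b → Coherent (profileOf shj a) (profileOf shk b)
  coherent {j} {k} (triple r tr r-inj) (triple r' tr' r'-inj) a b {i} {i'} {l} {l'} i≢i' rᵢ≡r'ₗ rᵢ'≡r'ₗ' =
    third≡ , trans (value-parity j a) (trans (κ-equal j k j≗k) (sym (value-parity k b)))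
    where
    l≢l' : l ≢ l'
    l≢l' refl = i≢i' (r-inj (trans rᵢ≡r'ₗ (sym rᵢ'≡r'ₗ')))
    r₃ = r (third i i')
    r'₃ = r' (third l l')
    expand : ∀ {k} (ρ : Fin 3 → Fin n) → (∀ p → term k p ≡ suc (ρ p)) → ∀ {i i'} → i ≢ i' → ∀ x →
             reduced k x ≡ form (suc (ρ i)) x xor (form (suc (ρ i')) x xor form (suc (ρ (third i i'))) x)
    expand {k} ρ tρ {i} {i'} i≢i' x = trans (xor3-third (λ p → form (term k p) x) i≢i')
      (cong₂ _xor_ (at (tρ i)) (cong₂ _xor_ (at (tρ i')) (at (tρ (third i i')))))
      where
      at : ∀ {t t'} → t ≡ t' → form t x ≡ form t' x
      at = cong (λ t → form t x)
    sum≗ : reduced j ⊕ reduced k ≗ form (suc r₃) ⊕ form (suc r'₃)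
    sum≗ x = trans (cong₂ _xor_ (expand r tr i≢i' x) (expand r' tr' l≢l' x))
      (trans (cong₂ (λ u v → (form (suc u) x xor (form (suc v) x xor form (suc r₃) x)) xor
                             (form (suc (r' l)) x xor (form (suc (r' l')) x xor form (suc r'₃) x))) rᵢ≡r'ₗ rᵢ'≡r'ₗ')
             (cancel (form (suc (r' l)) x) (form (suc (r' l')) x) (form (suc r₃) x) (form (suc r'₃) x)))
      where
      cancel : ∀ a b c c' → (a xor (b xor c)) xor (a xor (b xor c')) ≡ c xor c'
      cancel = solve-∀ xor-ring
    j≗k : reduced j ≗ reduced k
    j≗k = pair-closed j k (subst (_≤ 2) (sym (width-cong sum≗)) (width₂ (suc r₃) (suc r'₃)))
    third≡ : r₃ ≡ r'₃
    third≡ = sym (Fin.suc-injective (form-true (suc r'₃) r₃ (hit (form (suc r'₃) r₃)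
               (trans (sym (cong (_xor form (suc r'₃) r₃) (form-self r₃))) (trans (sym (sum≗ r₃))
                      (trans (cong (_xor reduced k r₃) (j≗k r₃)) (xor-same (reduced k r₃))))))))
      where
      hit : ∀ c → true xor c ≡ false → c ≡ true
      hit true _ = refl
  coherent {k = k} (triple _ _ _) (double {i} {i'} _ _ _ _ _) a b with value k b (third i i')
  ... | true  = tt
  ... | false = tt
  coherent {k = k} (triple _ _ _) (fixed _) a b with value k b 0F ∨ value k b 1F ∨ value k b 2F
  ... | true  = tt
  ... | false = tt
  coherent {j} (double {i} {i'} _ _ _ _ _) _ a b with value j a (third i i')
  ... | true  = tt
  ... | false = tt
  coherent {j} (fixed _) _ a b with value j a 0F ∨ value j a 1F ∨ value j a 2F
  ... | true  = tt
  ... | false = tt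

  gram-dead-left : ∀ {P : Profile n} P' → P ≡ dead → gram P P' ≡ 0ℤ
  gram-dead-left P' refl = gram-dead P'

  gram-dead-right : ∀ P {P' : Profile n} → P' ≡ dead → gram P P' ≡ 0ℤ
  gram-dead-right P refl = trans (gram-sym P dead) (gram-dead P)

  conflict-orthogonal : ∀ j a k b p q → clauseVar j p ≡ clauseVar k q → varValue (φ j) a p ≢ varValue (φ k) b q →
                        gram (profile j a) (profile k b) ≡ 0ℤ
  conflict-orthogonal j a k b p q same-var differ = by-term (term j p) refl
    where
    P = profile j a
    P' = profile k b
    value-varValue : ∀ j a p → value j a p ≡ varValue (φ j) a p xor shift (clauseVar j p)
    value-varValue j a p = sym (xor-assoc (oddAssignment a p) (neg (lit (φ j) p)) (shift (clauseVar j p)))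
    values-differ : value j a p ≢ value k b q
    values-differ v≡v' = differ (xor-cancelʳ _ _ (shift (clauseVar j p))
      (trans (sym (value-varValue j a p)) (trans v≡v' (trans (value-varValue k b q)
        (cong (λ x → varValue (φ k) b q xor shift x) (sym same-var))))))
    by-term : ∀ t → term j p ≡ t → gram P P' ≡ 0ℤ
    by-term (suc r) tp with assigns-root (shape j) a p tp | assigns-root (shape k) b q (trans (cong rep (sym same-var)) tp)
    ... | inj₁ dead≡ | _          = gram-dead-left P' dead≡
    ... | inj₂ _     | inj₁ dead≡ = gram-dead-right P dead≡
    ... | inj₂ A     | inj₂ A'    = Vanishing.vanishes (gram-agreement P P' (coherent (shape j) (shape k) a b))
                                      (r , value j a p , A , subst (Assigns P' r) (¬-not (values-differ ∘ sym)) A')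
    by-term zero tp with fixed-false (shape j) a p tp | fixed-false (shape k) b q (trans (cong rep (sym same-var)) tp)
    ... | inj₁ dead≡ | _          = gram-dead-left P' dead≡
    ... | inj₂ _     | inj₁ dead≡ = gram-dead-right P dead≡
    ... | inj₂ v≡f   | inj₂ v'≡f  = ⊥-elim (values-differ (trans v≡f (sym v'≡f)))

-- Vectors over the reals

module RealVectors (ℝ : RealField) where
  open RealField ℝ
  open Theta ℝ

  ring : CommutativeRing 0ℓ 0ℓ
  ring = record { isCommutativeRing = isCommutativeRing }

  open CommutativeRing ring public using (+-assoc; +-comm; +-identityˡ; +-identityʳ; -‿inverseˡ; -‿inverseʳ;
                                          *-comm; *-assoc; *-identityˡ; *-identityʳ; distribʳ; zeroˡ; zeroʳ)
  open import Algebra.Properties.Ring (CommutativeRing.ring ring) using (-‿distribˡ-*; -‿distribʳ-*; -‿involutive; -0#≈0#; -‿+-comm)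
  open SumProperties (CommutativeRing.semiring ring) public
  open IsTotalOrder isTotalOrder using (total; antisym) renaming (refl to ≤-refl; trans to ≤-trans)
  open import Tactic.RingSolver.NonReflective (fromCommutativeRing ring λ _ → nothing)
    using (solve; _⊜_) renaming (_⊕_ to _:+_; _⊗_ to _:*_)

  sumF≡sum : ∀ {k} (f : Fin k → Carrier) → sumF f ≡ sum f
  sumF≡sum {zero}  f = refl
  sumF≡sum {suc k} f = cong (λ z → f zero + z) (sumF≡sum (f ∘ suc))

  +-mono-≤ : ∀ {a b c d} → a ≤ b → c ≤ d → a + c ≤ b + d
  +-mono-≤ {a} {b} {c} {d} a≤b c≤d =
    ≤-trans (+-mono a b c a≤b) (subst₂ _≤_ (+-comm c b) (+-comm d b) (+-mono c d b c≤d))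

  nonneg-+ : ∀ {a b} → 0# ≤ a → 0# ≤ b → 0# ≤ a + b
  nonneg-+ 0≤a 0≤b = subst (_≤ _) (+-identityˡ 0#) (+-mono-≤ 0≤a 0≤b)

  nonpos⇒-nonneg : ∀ {x} → x ≤ 0# → 0# ≤ - x
  nonpos⇒-nonneg {x} x≤0 = subst₂ _≤_ (-‿inverseʳ x) (+-identityˡ (- x)) (+-mono x 0# (- x) x≤0)

  neg*neg : ∀ x → - x * - x ≡ x * x
  neg*neg x = trans (sym (-‿distribˡ-* x (- x))) (trans (cong -_ (sym (-‿distribʳ-* x x))) (-‿involutive (x * x)))

  square-nonneg : ∀ x → 0# ≤ x * x
  square-nonneg x with total 0# x
  ... | inj₁ 0≤x = *-nonneg x x 0≤x 0≤x
  ... | inj₂ x≤0 = subst (0# ≤_) (neg*neg x) (*-nonneg (- x) (- x) (nonpos⇒-nonneg x≤0) (nonpos⇒-nonneg x≤0))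

  0≤1 : 0# ≤ 1#
  0≤1 = subst (0# ≤_) (*-identityˡ 1#) (square-nonneg 1#)

  0≤fromℕ : ∀ k → 0# ≤ fromℕ k
  0≤fromℕ zero    = ≤-refl
  0≤fromℕ (suc k) = nonneg-+ 0≤1 (0≤fromℕ k)

  ≤-of-nonneg-difference : ∀ {a b} → 0# ≤ a + - b → b ≤ a
  ≤-of-nonneg-difference {a} {b} 0≤a-b = subst₂ _≤_ (+-identityˡ b) a-b+b≡a (+-mono 0# (a + - b) b 0≤a-b)
    where
    a-b+b≡a : (a + - b) + b ≡ a
    a-b+b≡a = trans (+-assoc a (- b) b) (trans (cong (λ z → a + z) (-‿inverseˡ b)) (+-identityʳ a))

  sum-mono : ∀ {k} (f g : Fin k → Carrier) → (∀ i → f i ≤ g i) → sum f ≤ sum g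
  sum-mono {zero}  f g f≤g = ≤-refl
  sum-mono {suc k} f g f≤g = +-mono-≤ (f≤g zero) (sum-mono (f ∘ suc) (g ∘ suc) (f≤g ∘ suc))

  sum-nonneg : ∀ {k} (f : Fin k → Carrier) → (∀ i → 0# ≤ f i) → 0# ≤ sum f
  sum-nonneg {zero}  f 0≤f = ≤-refl
  sum-nonneg {suc k} f 0≤f = nonneg-+ (0≤f zero) (sum-nonneg (f ∘ suc) (0≤f ∘ suc))

  sum-neg : ∀ {k} (f : Fin k → Carrier) → sum (λ i → - f i) ≡ - sum f
  sum-neg {zero}  f = sym -0#≈0#
  sum-neg {suc k} f = trans (cong (λ z → - f zero + z) (sum-neg (f ∘ suc))) (-‿+-comm (f zero) (sum (f ∘ suc)))

  sum-ones : ∀ k → sum {k} (λ _ → 1#) ≡ fromℕ k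
  sum-ones zero    = refl
  sum-ones (suc k) = cong (λ z → 1# + z) (sum-ones k)

  sign : Sign.Sign → Carrier
  sign Sign.+ = 1#
  sign Sign.- = - 1#

  ι : ℤ → Carrier
  ι (+ k)    = fromℕ k
  ι -[1+ k ] = - fromℕ (suc k)

  fromℕ-+ : ∀ a b → fromℕ (a ℕ.+ b) ≡ fromℕ a + fromℕ b
  fromℕ-+ zero    b = sym (+-identityˡ (fromℕ b))
  fromℕ-+ (suc a) b = trans (cong (λ z → 1# + z) (fromℕ-+ a b)) (sym (+-assoc 1# (fromℕ a) (fromℕ b)))

  fromℕ-* : ∀ a b → fromℕ (a ℕ.* b) ≡ fromℕ a * fromℕ b
  fromℕ-* zero    b = sym (zeroˡ (fromℕ b))
  fromℕ-* (suc a) b = trans (fromℕ-+ b (a ℕ.* b))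
    (trans (cong₂ _+_ (sym (*-identityˡ (fromℕ b))) (fromℕ-* a b)) (sym (distribʳ (fromℕ b) 1# (fromℕ a))))

  -1*x≡-x : ∀ x → - 1# * x ≡ - x
  -1*x≡-x x = trans (sym (-‿distribˡ-* 1# x)) (cong -_ (*-identityˡ x))

  ι-◃ : ∀ s k → ι (s ℤ.◃ k) ≡ sign s * fromℕ k
  ι-◃ s       zero    = sym (zeroʳ (sign s))
  ι-◃ Sign.+ (suc k) = sym (*-identityˡ (fromℕ (suc k)))
  ι-◃ Sign.- (suc k) = sym (-1*x≡-x (fromℕ (suc k)))

  ι-sign-abs : ∀ i → ι i ≡ sign (ℤ.sign i) * fromℕ ℤ.∣ i ∣
  ι-sign-abs i = trans (cong ι (sym (ℤ.◃-inverse i))) (ι-◃ (ℤ.sign i) ℤ.∣ i ∣)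

  sign-* : ∀ s t → sign (s Sign.* t) ≡ sign s * sign t
  sign-* Sign.+ t      = sym (*-identityˡ (sign t))
  sign-* Sign.- Sign.+ = sym (*-identityʳ (- 1#))
  sign-* Sign.- Sign.- = sym (trans (-1*x≡-x (- 1#)) (-‿involutive 1#))

  ι-* : ∀ i j → ι (i ℤ.* j) ≡ ι i * ι j
  ι-* i j = begin
    ι (i ℤ.* j)                                     ≡⟨ ι-◃ (ℤ.sign i Sign.* ℤ.sign j) (ℤ.∣ i ∣ ℕ.* ℤ.∣ j ∣) ⟩
    sign (ℤ.sign i Sign.* ℤ.sign j) * fromℕ (ℤ.∣ i ∣ ℕ.* ℤ.∣ j ∣)
      ≡⟨ cong₂ _*_ (sign-* (ℤ.sign i) (ℤ.sign j)) (fromℕ-* ℤ.∣ i ∣ ℤ.∣ j ∣) ⟩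
    (sign (ℤ.sign i) * sign (ℤ.sign j)) * (fromℕ ℤ.∣ i ∣ * fromℕ ℤ.∣ j ∣)
      ≡⟨ solve 4 (λ a b c d → ((a :* b) :* (c :* d)) ⊜ ((a :* c) :* (b :* d))) refl _ _ _ _ ⟩
    (sign (ℤ.sign i) * fromℕ ℤ.∣ i ∣) * (sign (ℤ.sign j) * fromℕ ℤ.∣ j ∣)
      ≡⟨ sym (cong₂ _*_ (ι-sign-abs i) (ι-sign-abs j)) ⟩
    ι i * ι j                                       ∎
    where open ≡-Reasoning

  ι-⊖ : ∀ a b → ι (a ℤ.⊖ b) ≡ fromℕ a + - fromℕ b
  ι-⊖ a       zero    = sym (trans (cong (λ z → fromℕ a + z) -0#≈0#) (+-identityʳ (fromℕ a)))
  ι-⊖ zero    (suc b) = sym (+-identityˡ _)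
  ι-⊖ (suc a) (suc b) = trans (cong ι (ℤ.[1+m]⊖[1+n]≡m⊖n a b)) (trans (ι-⊖ a b) (sym cancel))
    where
    cancel : (1# + fromℕ a) + - (1# + fromℕ b) ≡ fromℕ a + - fromℕ b
    cancel = begin
      (1# + fromℕ a) + - (1# + fromℕ b)         ≡⟨ cong (λ z → (1# + fromℕ a) + z) (sym (-‿+-comm 1# (fromℕ b))) ⟩
      (1# + fromℕ a) + (- 1# + - fromℕ b)
        ≡⟨ solve 4 (λ o x o' y → ((o :+ x) :+ (o' :+ y)) ⊜ ((x :+ y) :+ (o :+ o'))) refl 1# (fromℕ a) (- 1#) (- fromℕ b) ⟩
      (fromℕ a + - fromℕ b) + (1# + - 1#)       ≡⟨ cong (λ z → (fromℕ a + - fromℕ b) + z) (-‿inverseʳ 1#) ⟩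
      (fromℕ a + - fromℕ b) + 0#                ≡⟨ +-identityʳ _ ⟩
      fromℕ a + - fromℕ b                       ∎
      where open ≡-Reasoning

  ι-+ : ∀ i j → ι (i ℤ.+ j) ≡ ι i + ι j
  ι-+ (+ a)    (+ b)    = fromℕ-+ a b
  ι-+ (+ a)    -[1+ b ] = ι-⊖ a (suc b)
  ι-+ -[1+ a ] (+ b)    = trans (ι-⊖ b (suc a)) (+-comm (fromℕ b) (- fromℕ (suc a)))
  ι-+ -[1+ a ] -[1+ b ] = trans (cong -_ (trans (cong (λ z → 1# + (1# + z)) (fromℕ-+ a b))
    (solve 3 (λ o x y → (o :+ (o :+ (x :+ y))) ⊜ ((o :+ x) :+ (o :+ y))) refl 1# (fromℕ a) (fromℕ b))))
    (sym (-‿+-comm (fromℕ (suc a)) (fromℕ (suc b))))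

  ι-nonneg : ∀ {i} → 0ℤ ℤ.≤ i → 0# ≤ ι i
  ι-nonneg {+ k} _ = 0≤fromℕ k

  ι-sum : ∀ {k} (f : Fin k → ℤ) → ι (ℤ∑.sum f) ≡ sum (ι ∘ f)
  ι-sum {zero}  f = refl
  ι-sum {suc k} f = trans (ι-+ (f zero) (ℤ∑.sum (f ∘ suc))) (cong (λ z → ι (f zero) + z) (ι-sum (f ∘ suc)))

  _-ᵛ_ : ∀ {d} → (Fin d → Carrier) → (Fin d → Carrier) → Fin d → Carrier
  (x -ᵛ y) i = x i + - y i

  ∑ᵛ : ∀ {d k} → (Fin k → Fin d → Carrier) → Fin d → Carrier
  ∑ᵛ {k = k} u i = ∑[ a < k ] u a i

  _·ᵛ_ : ∀ {d} → Carrier → (Fin d → Carrier) → Fin d → Carrier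
  (c ·ᵛ x) i = c * x i

  module _ {d : ℕ} where

    ⟨⟩≡∑ : ∀ (x y : Fin d → Carrier) → ⟨ x , y ⟩ ≡ ∑[ i < d ] (x i * y i)
    ⟨⟩≡∑ x y = sumF≡sum (λ i → x i * y i)

    ⟨⟩-sym : ∀ (x y : Fin d → Carrier) → ⟨ x , y ⟩ ≡ ⟨ y , x ⟩
    ⟨⟩-sym x y = trans (⟨⟩≡∑ x y) (trans (sum-cong-≗ λ i → *-comm (x i) (y i)) (sym (⟨⟩≡∑ y x)))

    ⟨⟩-nonneg : ∀ (x : Fin d → Carrier) → 0# ≤ ⟨ x , x ⟩
    ⟨⟩-nonneg x = subst (0# ≤_) (sym (⟨⟩≡∑ x x)) (sum-nonneg _ λ i → square-nonneg (x i))

    ⟨⟩-∑ᵛ : ∀ {k} (x : Fin d → Carrier) (u : Fin k → Fin d → Carrier) → ⟨ x , ∑ᵛ u ⟩ ≡ ∑[ a < k ] ⟨ x , u a ⟩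
    ⟨⟩-∑ᵛ {k} x u = begin
      ⟨ x , ∑ᵛ u ⟩                    ≡⟨ ⟨⟩≡∑ x (∑ᵛ u) ⟩
      ∑[ i < d ] (x i * ∑ᵛ u i)       ≡⟨ sum-cong-≗ (λ i → *-distribˡ-sum (x i) (λ a → u a i)) ⟩
      ∑[ i < d ] ∑[ a < k ] (x i * u a i) ≡⟨ ∑-comm (λ i a → x i * u a i) ⟩
      ∑[ a < k ] ∑[ i < d ] (x i * u a i) ≡⟨ sum-cong-≗ (λ a → sym (⟨⟩≡∑ x (u a))) ⟩
      ∑[ a < k ] ⟨ x , u a ⟩          ∎
      where open ≡-Reasoning

    ⟨⟩-scaleˡ : ∀ c (x y : Fin d → Carrier) → ⟨ c ·ᵛ x , y ⟩ ≡ c * ⟨ x , y ⟩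
    ⟨⟩-scaleˡ c x y = trans (⟨⟩≡∑ (c ·ᵛ x) y) (trans (sum-cong-≗ λ i → *-assoc c (x i) (y i))
                        (trans (sym (*-distribˡ-sum c (λ i → x i * y i))) (cong (c *_) (sym (⟨⟩≡∑ x y)))))

    ⟨⟩-scaleʳ : ∀ c (x y : Fin d → Carrier) → ⟨ x , c ·ᵛ y ⟩ ≡ c * ⟨ x , y ⟩
    ⟨⟩-scaleʳ c x y = trans (⟨⟩-sym x (c ·ᵛ y)) (trans (⟨⟩-scaleˡ c y x) (cong (c *_) (⟨⟩-sym y x)))

    ⟨⟩-ι : ∀ (F G : Fin d → ℤ) → ⟨ ι ∘ F , ι ∘ G ⟩ ≡ ι (ℤ∑.sum λ i → F i ℤ.* G i)
    ⟨⟩-ι F G = trans (⟨⟩≡∑ (ι ∘ F) (ι ∘ G))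
                     (trans (sum-cong-≗ λ i → sym (ι-* (F i) (G i))) (sym (ι-sum λ i → F i ℤ.* G i)))

    ⟨⟩-distance : ∀ (x y : Fin d → Carrier) →
                  ⟨ x -ᵛ y , x -ᵛ y ⟩ ≡ (⟨ x , x ⟩ + - ⟨ x , y ⟩) + (- ⟨ y , x ⟩ + ⟨ y , y ⟩)
    ⟨⟩-distance x y = begin
      ⟨ x -ᵛ y , x -ᵛ y ⟩ ≡⟨ ⟨⟩≡∑ (x -ᵛ y) (x -ᵛ y) ⟩
      ∑[ i < d ] ((x i + - y i) * (x i + - y i))
        ≡⟨ sum-cong-≗ (λ i → expand (x i) (y i)) ⟩
      ∑[ i < d ] ((x i * x i + - (x i * y i)) + (- (y i * x i) + y i * y i))
        ≡⟨ ∑-distrib-+ (λ i → x i * x i + - (x i * y i)) (λ i → - (y i * x i) + y i * y i) ⟩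
      ∑[ i < d ] (x i * x i + - (x i * y i)) + ∑[ i < d ] (- (y i * x i) + y i * y i)
        ≡⟨ cong₂ _+_ (trans (∑-distrib-+ (λ i → x i * x i) (λ i → - (x i * y i)))
                            (cong₂ _+_ (sym (⟨⟩≡∑ x x)) (trans (sum-neg (λ i → x i * y i)) (cong -_ (sym (⟨⟩≡∑ x y))))))
                     (trans (∑-distrib-+ (λ i → - (y i * x i)) (λ i → y i * y i))
                            (cong₂ _+_ (trans (sum-neg (λ i → y i * x i)) (cong -_ (sym (⟨⟩≡∑ y x)))) (sym (⟨⟩≡∑ y y)))) ⟩
      (⟨ x , x ⟩ + - ⟨ x , y ⟩) + (- ⟨ y , x ⟩ + ⟨ y , y ⟩) ∎
      where
      open ≡-Reasoning
      expand : ∀ a b → (a + - b) * (a + - b) ≡ (a * a + - (a * b)) + (- (b * a) + b * b)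
      expand a b =
        trans (solve 4 (λ p q r t → ((p :+ r) :* (q :+ t)) ⊜ (((p :* q) :+ (p :* t)) :+ ((r :* q) :+ (r :* t)))) refl a a (- b) (- b))
              (cong₂ _+_ (cong (λ z → a * a + z) (sym (-‿distribʳ-* a b))) (cong₂ _+_ (sym (-‿distribˡ-* b a)) (neg*neg b)))

    clique-bound : ∀ {k} (v₀ : Fin d → Carrier) (u : Fin k → Fin d → Carrier) → ⟨ v₀ , v₀ ⟩ ≡ 1# →
                   (∀ a → ⟨ u a , u a ⟩ ≡ ⟨ u a , v₀ ⟩) → (∀ a b → a ≢ b → ⟨ u a , u b ⟩ ≡ 0#) →
                   ∑[ a < k ] ⟨ v₀ , u a ⟩ ≤ 1#
    clique-bound {k} v₀ u unit diagonal orthogonal =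
      ≤-of-nonneg-difference (subst (0# ≤_) distance≡ (⟨⟩-nonneg (v₀ -ᵛ S)))
      where
      S = ∑ᵛ u
      T = ∑[ a < k ] ⟨ v₀ , u a ⟩
      ⟨v₀,S⟩ : ⟨ v₀ , S ⟩ ≡ T
      ⟨v₀,S⟩ = ⟨⟩-∑ᵛ v₀ u
      ⟨S,S⟩ : ⟨ S , S ⟩ ≡ T
      ⟨S,S⟩ = begin
        ⟨ S , S ⟩                          ≡⟨ ⟨⟩-∑ᵛ S u ⟩
        ∑[ a < k ] ⟨ S , u a ⟩             ≡⟨ sum-cong-≗ (λ a → trans (⟨⟩-sym S (u a)) (⟨⟩-∑ᵛ (u a) u)) ⟩
        ∑[ a < k ] ∑[ b < k ] ⟨ u a , u b ⟩
          ≡⟨ sum-cong-≗ (λ a → sum-single (λ b → ⟨ u a , u b ⟩) a λ b b≢a → orthogonal a b (b≢a ∘ sym)) ⟩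
        ∑[ a < k ] ⟨ u a , u a ⟩           ≡⟨ sum-cong-≗ (λ a → trans (diagonal a) (⟨⟩-sym (u a) v₀)) ⟩
        T                                  ∎
        where open ≡-Reasoning
      distance≡ : ⟨ v₀ -ᵛ S , v₀ -ᵛ S ⟩ ≡ 1# + - T
      distance≡ = begin
        ⟨ v₀ -ᵛ S , v₀ -ᵛ S ⟩                                    ≡⟨ ⟨⟩-distance v₀ S ⟩
        (⟨ v₀ , v₀ ⟩ + - ⟨ v₀ , S ⟩) + (- ⟨ S , v₀ ⟩ + ⟨ S , S ⟩)
          ≡⟨ cong₂ (λ a b → (a + - b) + (- ⟨ S , v₀ ⟩ + ⟨ S , S ⟩)) unit ⟨v₀,S⟩ ⟩
        (1# + - T) + (- ⟨ S , v₀ ⟩ + ⟨ S , S ⟩)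
          ≡⟨ cong₂ (λ a b → (1# + - T) + (- a + b)) (trans (⟨⟩-sym S v₀) ⟨v₀,S⟩) ⟨S,S⟩ ⟩
        (1# + - T) + (- T + T)                                    ≡⟨ cong (λ z → (1# + - T) + z) (-‿inverseˡ T) ⟩
        (1# + - T) + 0#                                           ≡⟨ +-identityʳ _ ⟩
        1# + - T                                                  ∎
        where open ≡-Reasoning

  quarter : ∃ λ q → fromℕ 4 * q ≡ 1# × 0# ≤ q
  quarter = q , 4q≡1 , 0≤q
    where
    1≤4 : 1# ≤ fromℕ 4
    1≤4 = subst (_≤ fromℕ 4) (+-identityʳ 1#) (+-mono-≤ ≤-refl (0≤fromℕ 3))
    4≢0 : fromℕ 4 ≢ 0#
    4≢0 4≡0 = 0≢1 (antisym 0≤1 (subst (1# ≤_) 4≡0 1≤4))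
    q = proj₁ (inverse (fromℕ 4) 4≢0)
    4q≡1 : fromℕ 4 * q ≡ 1#
    4q≡1 = proj₂ (inverse (fromℕ 4) 4≢0)
    0≤q : 0# ≤ q
    0≤q with total 0# q
    ... | inj₁ 0≤q = 0≤q
    ... | inj₂ q≤0 = ⊥-elim (0≢1 (antisym 0≤1 1≤0))
      where
      0≤-1 : 0# ≤ - 1#
      0≤-1 = subst (0# ≤_) (trans (sym (-‿distribʳ-* (fromℕ 4) q)) (cong -_ 4q≡1))
                   (*-nonneg _ _ (0≤fromℕ 4) (nonpos⇒-nonneg q≤0))
      1≤0 : 1# ≤ 0#
      1≤0 = subst₂ _≤_ (+-identityʳ 1#) (-‿inverseʳ 1#) (+-mono-≤ (≤-refl {1#}) 0≤-1)

-- The theta value of G_φ^xor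

-- XorAdj φ u v unfolds to Conflict φ (quotRem u) (quotRem v).
Conflict : ∀ {n m} → CNF3 n m → Fin 4 × Fin m → Fin 4 × Fin m → Set
Conflict φ (a , j) (b , k) = ∃[ p ] ∃[ q ] (var (lit (φ j) p) ≡ var (lit (φ k) q) × ¬ (varValue (φ j) a p ≡ varValue (φ k) b q))

quotRem-combine : ∀ {m} (j : Fin m) (a : Fin 4) → quotRem {m} 4 (combine j a) ≡ (a , j)
quotRem-combine j a = cong swap (Fin.remQuot-combine j a)

cloud-clique : ∀ {n m} (φ : CNF3 n m) j a b → a ≢ b → XorAdj φ (combine j a) (combine j b)
cloud-clique φ j a b a≢b = subst₂ (Conflict φ) (sym (quotRem-combine j a)) (sym (quotRem-combine j b))
  (p , p , refl , differ ∘ xor-cancelʳ _ _ (neg (lit (φ j) p)))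
  where
  p = proj₁ (odd-assignments-differ a b a≢b)
  differ = proj₂ (odd-assignments-differ a b a≢b)

module Main (ℝ : RealField) {n m : ℕ} (φ : CNF3 n m) where
  open RealField ℝ
  open Theta ℝ
  open RealVectors ℝ

  objective-by-clause : ∀ {d} (v₀ : Fin d → Carrier) (v : Fin (m ℕ.* 4) → Fin d → Carrier) →
                        objective v₀ v ≡ ∑[ j < m ] (∑[ a < 4 ] ⟨ v₀ , v (combine j a) ⟩)
  objective-by-clause v₀ v = trans (sumF≡sum (λ i → ⟨ v₀ , v i ⟩))
    (trans (sum-cong-≗ {x = λ i → ⟨ v₀ , v i ⟩} λ i → cong (λ i → ⟨ v₀ , v i ⟩) (sym (Fin.combine-remQuot {m} 4 i)))
                                  (sum-quotRem m λ (a , j) → ⟨ v₀ , v (combine j a) ⟩))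

  upper : ∀ d v₀ v → Feasible (XorAdj φ) d v₀ v → objective v₀ v ≤ fromℕ m
  upper d v₀ v (unit , diagonal , _ , _ , orthogonal) =
    subst₂ _≤_ (sym (objective-by-clause v₀ v)) (sum-ones m) (sum-mono _ _ λ j →
      clique-bound v₀ (v ∘ combine j) unit (λ a → diagonal (combine j a))
                   (λ a b a≢b → orthogonal (combine j a) (combine j b) (cloud-clique φ j a b a≢b)))

  module Lower {unrefuted : ¬ GE3Refutes φ} (S : Formula.Substitution φ unrefuted)
               (closed : Formula.Closed φ unrefuted S) where
    open Vertices S closed using (profile; coherent; shape; weights; conflict-orthogonal)

    q : Carrier
    q = proj₁ quarter

    4q≡1 : fromℕ 4 * q ≡ 1#
    4q≡1 = proj₁ (proj₂ quarter)

    0≤q : 0# ≤ q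
    0≤q = proj₂ (proj₂ quarter)

    e₀ : Fin (ℕ.suc n) → Carrier
    e₀ = ι ∘ δ zero

    vertex : Fin 4 × Fin m → Fin (ℕ.suc n) → Carrier
    vertex (a , j) = q ·ᵛ (ι ∘ vector (profile j a))

    v : Fin (m ℕ.* 4) → Fin (ℕ.suc n) → Carrier
    v = vertex ∘ quotRem {m} 4

    e₀·e₀ : ⟨ e₀ , e₀ ⟩ ≡ 1#
    e₀·e₀ = begin
      ⟨ e₀ , e₀ ⟩                                       ≡⟨ ⟨⟩-ι (δ {ℕ.suc n} zero) (δ zero) ⟩
      ι (ℤ∑.sum λ y → δ zero y ℤ.* δ {ℕ.suc n} zero y)   ≡⟨ cong ι (δ-sum {ℕ.suc n} zero (δ zero)) ⟩
      ι 1ℤ                                              ≡⟨ +-identityʳ 1# ⟩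
      1#                                                ∎
      where open ≡-Reasoning

    e₀·vertex : ∀ a j → ⟨ e₀ , vertex (a , j) ⟩ ≡ q * fromℕ (weight (profile j a))
    e₀·vertex a j = trans (⟨⟩-scaleʳ q e₀ (ι ∘ vector P)) (cong (q *_) (trans (⟨⟩-ι (δ zero) (vector P)) (cong ι (gram-e₀ P))))
      where P = profile j a

    vertex·vertex : ∀ a j b k → ⟨ vertex (a , j) , vertex (b , k) ⟩ ≡ q * (q * ι (gram (profile j a) (profile k b)))
    vertex·vertex a j b k =
      trans (⟨⟩-scaleˡ q (ι ∘ vector P) (vertex (b , k)))
            (cong (q *_) (trans (⟨⟩-scaleʳ q (ι ∘ vector P) (ι ∘ vector P')) (cong (q *_) (⟨⟩-ι (vector P) (vector P')))))
      where
      P = profile j a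
      P' = profile k b

    norm : ∀ a j → ⟨ vertex (a , j) , vertex (a , j) ⟩ ≡ ⟨ vertex (a , j) , e₀ ⟩
    norm a j = begin
      ⟨ vertex (a , j) , vertex (a , j) ⟩        ≡⟨ vertex·vertex a j a j ⟩
      q * (q * ι (gram P P))                    ≡⟨ cong (λ g → q * (q * ι g)) (gram-self P) ⟩
      q * (q * ι (+ 4 ℤ.* + weight P))          ≡⟨ cong (λ g → q * (q * g)) (ι-* (+ 4) (+ weight P)) ⟩
      q * (q * (fromℕ 4 * fromℕ (weight P)))   ≡⟨ cong (q *_) (sym (*-assoc q (fromℕ 4) _)) ⟩
      q * ((q * fromℕ 4) * fromℕ (weight P))   ≡⟨ cong (λ c → q * (c * fromℕ (weight P))) (trans (*-comm q (fromℕ 4)) 4q≡1) ⟩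
      q * (1# * fromℕ (weight P))              ≡⟨ cong (q *_) (*-identityˡ _) ⟩
      q * fromℕ (weight P)                     ≡⟨ sym (e₀·vertex a j) ⟩
      ⟨ e₀ , vertex (a , j) ⟩                    ≡⟨ ⟨⟩-sym e₀ (vertex (a , j)) ⟩
      ⟨ vertex (a , j) , e₀ ⟩                    ∎
      where
      open ≡-Reasoning
      P = profile j a

    e₀·vertex-nonneg : ∀ a j → 0# ≤ ⟨ e₀ , vertex (a , j) ⟩
    e₀·vertex-nonneg a j = subst (0# ≤_) (sym (e₀·vertex a j)) (*-nonneg q _ 0≤q (0≤fromℕ (weight (profile j a))))

    vertex·vertex-nonneg : ∀ a j b k → 0# ≤ ⟨ vertex (a , j) , vertex (b , k) ⟩
    vertex·vertex-nonneg a j b k = subst (0# ≤_) (sym (vertex·vertex a j b k)) (*-nonneg q _ 0≤q (*-nonneg q _ 0≤q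
      (ι-nonneg (Vanishing.nonneg (gram-agreement (profile j a) (profile k b) (coherent (shape j) (shape k) a b))))))

    conflict⇒orthogonal : ∀ a j b k → Conflict φ (a , j) (b , k) → ⟨ vertex (a , j) , vertex (b , k) ⟩ ≡ 0#
    conflict⇒orthogonal a j b k (p , p' , same , differ) = trans (vertex·vertex a j b k)
      (trans (cong (λ g → q * (q * ι g)) (conflict-orthogonal j a k b p p' same differ)) (trans (cong (q *_) (zeroʳ q)) (zeroʳ q)))

    feasible : Feasible (XorAdj φ) (ℕ.suc n) e₀ v
    feasible = e₀·e₀ , (λ _ → norm _ _) , (λ _ → e₀·vertex-nonneg _ _) , (λ _ _ → vertex·vertex-nonneg _ _ _ _)
             , λ _ _ → conflict⇒orthogonal _ _ _ _

    clause-total : ∀ j → ∑[ a < 4 ] ⟨ e₀ , vertex (a , j) ⟩ ≡ 1#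
    clause-total j = begin
      ∑[ a < 4 ] ⟨ e₀ , vertex (a , j) ⟩                  ≡⟨ sum-cong-≗ (λ a → e₀·vertex a j) ⟩
      ∑[ a < 4 ] (q * ι (+ weight (profile j a)))         ≡⟨ sym (*-distribˡ-sum q (λ a → ι (+ weight (profile j a)))) ⟩
      q * ∑[ a < 4 ] ι (+ weight (profile j a))          ≡⟨ cong (q *_) (sym (ι-sum (λ a → + weight (profile j a)))) ⟩
      q * ι (ℤ∑.sum λ a → + weight (profile j a))        ≡⟨ cong (λ w → q * ι w) (weights (shape j)) ⟩
      q * fromℕ 4                                         ≡⟨ trans (*-comm q (fromℕ 4)) 4q≡1 ⟩
      1#                                                  ∎
      where open ≡-Reasoning

    value : objective e₀ v ≡ fromℕ m
    value = begin
      objective e₀ v                                    ≡⟨ objective-by-clause e₀ v ⟩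
      ∑[ j < m ] (∑[ a < 4 ] ⟨ e₀ , v (combine j a) ⟩)
        ≡⟨ sum-cong-≗ (λ j → sum-cong-≗ λ a → cong (λ u → ⟨ e₀ , vertex u ⟩) (quotRem-combine j a)) ⟩
      ∑[ j < m ] (∑[ a < 4 ] ⟨ e₀ , vertex (a , j) ⟩)    ≡⟨ sum-cong-≗ clause-total ⟩
      ∑[ j < m ] 1#                                      ≡⟨ sum-ones m ⟩
      fromℕ m                                            ∎
      where open ≡-Reasoning

  theorem : ¬ GE3Refutes φ → ThetaEq (XorAdj φ) (fromℕ m)
  theorem unrefuted = upper , (ℕ.suc n , e₀ , v , feasible , value)
    where open Lower (proj₁ (Formula.closure φ unrefuted)) (proj₂ (Formula.closure φ unrefuted))

lemma2p5 : (ℝ : RealField) → (n m : ℕ) → (φ : CNF3 n m) →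
           ¬ GE3Refutes φ → Theta.ThetaEq ℝ (XorAdj φ) (Theta.fromℕ ℝ m)
lemma2p5 ℝ n m φ = Main.theorem ℝ φ
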